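{- Let $Q$ be a delta operator with umbral operator $\phi$, and let $g=\tilde Q^{ -1}$ be the compositional inverse of the indicator $\tilde Q$ of $Q$. Then for every $n\in\mathbb N$, \[ \phi\,\hat x^n=(\hat x(Q')^{ -1})^n\phi=\sum_{k=0}^n\hat x^k\,B_{n,k}\big(g^{(1)}(Q),g^{(2)}(Q),\dots,g^{(n-k+1)}(Q)\big)\phi, \] where $g^{(j)}$ is the $j$-th derivative of $g$.
   Context: $\mathbb K$ is a field of characteristic zero; operators are linear maps on $\mathbb K[x]$; $\hat x$ is multiplication by $x$, $D=d/dx$. Shift-invariant operators (commuting with all shifts) are $\tilde T(D)$ for a unique formal power series $\tilde T$ (the indicator). A delta operator is a shift-invariant $Q$ with $Qx$ a nonzero constant; its umbral operator $\phi$ is given by $\phi x^n=\phi_n(x)$, where $(\phi_n)$ is the unique polynomial sequence with $\deg\phi_n=n$, $\phi_0=1$, $\phi_n(0)=0$ ($n\ge1$), $Q\phi_n=n\phi_{n-1}$. The Pincherle derivative is $Q'=Q\hat x-\hat xQ$; for shift-invariant $Q$ it equals $(\tilde Q)'(D)$, and for a delta operator it is invertible. The partial Bell polynomials $B_{n,k}$ are defined by $\frac{1}{k!}\big(\sum_{j\ge1}a_j\frac{t^j}{j!}\big)^k=\sum_{n\ge k}B_{n,k}(a_1,\dots,a_{n-k+1})\frac{t^n}{n!}$ (with $B_{n,k}=0$ for $n<k$ and $B_{0,0}=1$); here they are evaluated at commuting shift-invariant operators. -}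

module Defs where

open import Level using (Level; _⊔_) renaming (suc to lsuc)
open import Data.Nat using (ℕ; zero; suc; _∸_; _<_)
open import Data.Nat.Base using (_!)
open import Data.List using (List; []; _∷_; [_]; map; length; replicate; _++_)
open import Data.Product using (Σ; _×_)
open import Algebra.Bundles using (CommutativeRing)
open import Relation.Nullary using (¬_)

embℕ : ∀ {c ℓ} (R : CommutativeRing c ℓ) → ℕ → CommutativeRing.Carrier R
embℕ R zero    = CommutativeRing.0# R
embℕ R (suc n) = CommutativeRing._+_ R (CommutativeRing.1# R) (embℕ R n)

-- a field of characteristic zero (inverse given as a total function,
-- specified only on nonzero elements)
record CharZeroField c ℓ : Set (lsuc (c ⊔ ℓ)) where
  field
    commRing : CommutativeRing c ℓ
  open CommutativeRing commRing public hiding (ring)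
  field
    _⁻¹      : Carrier → Carrier
    inverseʳ : ∀ x → ¬ (x ≈ 0#) → (x * (x ⁻¹)) ≈ 1#
    0≉1      : ¬ (0# ≈ 1#)
    charZero : ∀ n → ¬ (embℕ commRing (suc n) ≈ 0#)

module Over {c ℓ} (F : CharZeroField c ℓ) where
  open CharZeroField F

  fromℕ : ℕ → Carrier
  fromℕ = embℕ commRing

  Series : Set c
  Series = ℕ → Carrier

  _≈S_ : Series → Series → Set ℓ
  f ≈S h = ∀ n → f n ≈ h n

  sumK : ℕ → (ℕ → Carrier) → Carrier
  sumK zero    f = 0#
  sumK (suc n) f = sumK n f + f n

  mulS : Series → Series → Series
  mulS f h n = sumK (suc n) (λ i → f i * h (n ∸ i))

  oneS : Series
  oneS zero    = 1#
  oneS (suc _) = 0#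

  powS : Series → ℕ → Series
  powS f zero    = oneS
  powS f (suc k) = mulS f (powS f k)

  tS : Series
  tS 1 = 1#
  tS _ = 0#

  -- composition f ∘ h (for h with zero constant term):
  -- (f ∘ h)_n = Σ_{k ≤ n} f_k (h^k)_n
  compS : Series → Series → Series
  compS f h n = sumK (suc n) (λ k → f k * powS h k n)

  derivS : Series → Series
  derivS f n = fromℕ (suc n) * f (suc n)

  derivN : ℕ → Series → Series
  derivN zero    f = f
  derivN (suc j) f = derivS (derivN j f)

  -- polynomials K[x] as coefficient lists (constant term first),
  -- compared coefficientwise (trailing zeros irrelevant)
  Poly : Set c
  Poly = List Carrier

  coeff : Poly → ℕ → Carrier
  coeff []      _       = 0#
  coeff (a ∷ p) zero    = a
  coeff (a ∷ p) (suc i) = coeff p i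

  _≋_ : Poly → Poly → Set ℓ
  p ≋ r = ∀ i → coeff p i ≈ coeff r i

  _⊕_ : Poly → Poly → Poly
  []      ⊕ r       = r
  (a ∷ p) ⊕ []      = a ∷ p
  (a ∷ p) ⊕ (b ∷ r) = (a + b) ∷ (p ⊕ r)

  _·_ : Carrier → Poly → Poly
  k · p = map (k *_) p

  ⊖_ : Poly → Poly
  ⊖ p = map -_ p

  sumP : ℕ → (ℕ → Poly) → Poly
  sumP zero    f = []
  sumP (suc n) f = sumP n f ⊕ f n

  mono : ℕ → Poly
  mono m = replicate m 0# ++ [ 1# ]

  Op : Set c
  Op = Poly → Poly

  idOp : Op
  idOp p = p

  zeroOp : Op
  zeroOp _ = []

  _∘O_ : Op → Op → Op
  (S ∘O T) p = S (T p)

  iter : ℕ → Op → Op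
  iter zero    T p = p
  iter (suc k) T p = T (iter k T p)

  xhat : Op
  xhat p = 0# ∷ p

  DAux : ℕ → Poly → Poly
  DAux k []      = []
  DAux k (a ∷ p) = (fromℕ k * a) ∷ DAux (suc k) p

  Dop : Op
  Dop []      = []
  Dop (_ ∷ p) = DAux 1 p

  -- f(T) for a power series f and a (locally nilpotent, degree
  -- lowering) operator T:  f(T) p = Σ_{k ≤ length p} f_k T^k p.
  -- (For T = D or T a delta operator, T^k p = 0 once k > deg p,
  -- so this is the usual f(T).)
  evalAt : Series → Op → Op
  evalAt f T p = sumP (suc (length p)) (λ k → f k · iter k T p)

  pincherle : Op → Op
  pincherle Q p = Q (xhat p) ⊕ (⊖ (xhat (Q p)))

  record IsDeltaWithIndicator (Q : Op) (q : Series) : Set (c ⊔ ℓ) where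
    field
      indicator : ∀ p → Q p ≋ evalAt q Dop p
      Qx-const  : Σ Carrier (λ a → (¬ (a ≈ 0#)) × (Q (mono 1) ≋ [ a ]))

  record IsBasicSequence (Q : Op) (φ : ℕ → Poly) : Set (c ⊔ ℓ) where
    field
      deg-top  : ∀ n → ¬ (coeff (φ n) n ≈ 0#)
      deg-high : ∀ n i → n < i → coeff (φ n) i ≈ 0#
      φ₀       : φ 0 ≋ [ 1# ]
      φₙ0      : ∀ n → coeff (φ (suc n)) 0 ≈ 0#
      lower    : ∀ n → Q (φ (suc n)) ≋ (fromℕ (suc n) · φ n)

  umbral : (ℕ → Poly) → Op
  umbral φ p = sumP (length p) (λ i → coeff p i · φ i)

  -- partial Bell polynomials evaluated at operators a 1, a 2, ...
  -- powCoeff a n k = [t^n] (Σ_{j≥1} a_j t^j / j!)^k   (operator-valued)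
  inv! : ℕ → Carrier
  inv! j = (fromℕ (j !)) ⁻¹

  powCoeff : (ℕ → Op) → ℕ → ℕ → Op
  powCoeff a zero    zero    p = p
  powCoeff a (suc n) zero    p = []
  powCoeff a n       (suc k) p =
    sumP n (λ i → inv! (suc i) · a (suc i) (powCoeff a (n ∸ suc i) k p))

  -- B_{n,k}(a_1, …, a_{n-k+1}) = (n!/k!) [t^n] (Σ_{j≥1} a_j t^j/j!)^k
  bell : (ℕ → Op) → ℕ → ℕ → Op
  bell a n k p = (fromℕ (n !) * inv! k) · powCoeff a n k p

-- Everything happens in the algebra of power series of the degree-lowering operators D and
-- Q = q(D).  There f(Q) = (f ∘ q)(D), so D = g(Q), and the commutator rule
-- f(T) x̂ − x̂ f(T) = f′(T) [T, x̂] (valid when [T, x̂] commutes with T) turns D x̂ − x̂ D = 1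
-- into g′(Q) Q′ = 1: hence Q′⁻¹ = g′(Q).
-- As Q (x̂ Q′⁻¹ φₙ) = (n + 1) φₙ = Q φₙ₊₁ and both x̂ Q′⁻¹ φₙ and φₙ₊₁ vanish at 0,
-- φₙ₊₁ = x̂ Q′⁻¹ φₙ, which is the first identity.  For the second, the operators aⱼ = g⁽ʲ⁾(Q)
-- commute and, by the commutator rule again, [aⱼ, x̂] a₁ = aⱼ₊₁; so expanding
-- (x̂ a₁)ⁿ⁺¹ = (x̂ a₁)ⁿ x̂ a₁ reproduces the Bell recurrence B_{n+1,k+1} = ∂ B_{n,k+1} + a₁ B_{n,k},
-- where ∂ = [-, x̂] a₁.
module Submission where

open import Level using (_⊔_)
open import Data.Nat as ℕ using (ℕ; zero; suc; _∸_; _≤_; _<_; z≤n; s≤s; _!)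
import Data.Nat.Properties as ℕ
open import Data.List using ([]; _∷_; [_]; length)
open import Data.Product using (_×_; _,_; proj₂)
open import Data.Sum using (inj₁; inj₂)
open import Relation.Nullary using (¬_)
open import Relation.Binary.PropositionalEquality as ≡ using (_≡_)
open import Algebra.Bundles using (CommutativeMonoid; AbelianGroup; CommutativeRing)
import Algebra.Properties.AbelianGroup as AbelianGroupProperties
import Algebra.Properties.CommutativeSemigroup as CommutativeSemigroupProperties
import Relation.Binary.Reasoning.Setoid as SetoidReasoning

open import Defs

n∸i≡1+[n∸1+i] : ∀ {n i} → i < n → n ∸ i ≡ suc (n ∸ suc i)
n∸i≡1+[n∸1+i] {suc n} (s≤s i≤n) = ℕ.+-∸-assoc 1 i≤n

module SumsIn {a b} (M : CommutativeMonoid a b) where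

  open CommutativeMonoid M
  open SetoidReasoning setoid
  open CommutativeSemigroupProperties commutativeSemigroup using (interchange)

  -- Stated for any ∑ unfolding like sumP and sumK, which then instantiate it with reflexivity proofs.
  module FiniteSums (∑ : ℕ → (ℕ → Carrier) → Carrier)
                    (∑-zero : ∀ f → ∑ 0 f ≈ ε)
                    (∑-suc : ∀ n f → ∑ (suc n) f ≈ ∑ n f ∙ f n) where

    ∑-cong< : ∀ n {f g} → (∀ k → k < n → f k ≈ g k) → ∑ n f ≈ ∑ n g
    ∑-cong< zero {f} {g} _ = trans (∑-zero f) (sym (∑-zero g))
    ∑-cong< (suc n) {f} {g} f≈g = begin
      ∑ (suc n) f  ≈⟨ ∑-suc n f ⟩
      ∑ n f ∙ f n  ≈⟨ ∙-cong (∑-cong< n (λ k k<n → f≈g k (ℕ.m<n⇒m<1+n k<n))) (f≈g n ℕ.≤-refl) ⟩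
      ∑ n g ∙ g n  ≈⟨ ∑-suc n g ⟨
      ∑ (suc n) g  ∎

    ∑-cong : ∀ n {f g} → (∀ k → f k ≈ g k) → ∑ n f ≈ ∑ n g
    ∑-cong n f≈g = ∑-cong< n (λ k _ → f≈g k)

    ∑-≈ε : ∀ n {f} → (∀ k → k < n → f k ≈ ε) → ∑ n f ≈ ε
    ∑-≈ε zero {f} _ = ∑-zero f
    ∑-≈ε (suc n) {f} f≈ε = begin
      ∑ (suc n) f  ≈⟨ ∑-suc n f ⟩
      ∑ n f ∙ f n  ≈⟨ ∙-cong (∑-≈ε n (λ k k<n → f≈ε k (ℕ.m<n⇒m<1+n k<n))) (f≈ε n ℕ.≤-refl) ⟩
      ε ∙ ε        ≈⟨ identityˡ ε ⟩
      ε            ∎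

    ∑-distrib-∙ : ∀ n (f g : ℕ → Carrier) → ∑ n (λ k → f k ∙ g k) ≈ ∑ n f ∙ ∑ n g
    ∑-distrib-∙ zero f g = begin
      ∑ 0 _          ≈⟨ ∑-zero _ ⟩
      ε              ≈⟨ identityˡ ε ⟨
      ε ∙ ε          ≈⟨ ∙-cong (∑-zero f) (∑-zero g) ⟨
      ∑ 0 f ∙ ∑ 0 g  ∎
    ∑-distrib-∙ (suc n) f g = begin
      ∑ (suc n) _                      ≈⟨ ∑-suc n _ ⟩
      ∑ n _ ∙ (f n ∙ g n)              ≈⟨ ∙-congʳ (∑-distrib-∙ n f g) ⟩
      (∑ n f ∙ ∑ n g) ∙ (f n ∙ g n)    ≈⟨ interchange _ _ _ _ ⟩
      (∑ n f ∙ f n) ∙ (∑ n g ∙ g n)    ≈⟨ ∙-cong (∑-suc n f) (∑-suc n g) ⟨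
      ∑ (suc n) f ∙ ∑ (suc n) g        ∎

    ∑-shift : ∀ n (f : ℕ → Carrier) → ∑ (suc n) f ≈ f 0 ∙ ∑ n (λ k → f (suc k))
    ∑-shift zero f = begin
      ∑ 1 f          ≈⟨ ∑-suc 0 f ⟩
      ∑ 0 f ∙ f 0    ≈⟨ ∙-congʳ (∑-zero f) ⟩
      ε ∙ f 0        ≈⟨ comm ε (f 0) ⟩
      f 0 ∙ ε        ≈⟨ ∙-congˡ (∑-zero _) ⟨
      f 0 ∙ ∑ 0 _    ∎
    ∑-shift (suc n) f = begin
      ∑ (suc (suc n)) f                        ≈⟨ ∑-suc (suc n) f ⟩
      ∑ (suc n) f ∙ f (suc n)                  ≈⟨ ∙-congʳ (∑-shift n f) ⟩
      (f 0 ∙ ∑ n (λ k → f (suc k))) ∙ f (suc n) ≈⟨ assoc _ _ _ ⟩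
      f 0 ∙ (∑ n (λ k → f (suc k)) ∙ f (suc n)) ≈⟨ ∙-congˡ (∑-suc n _) ⟨
      f 0 ∙ ∑ (suc n) (λ k → f (suc k))        ∎

    ∑-trim : ∀ L M {f} → (∀ k → L ≤ k → f k ≈ ε) → L ≤ M → ∑ M f ≈ ∑ L f
    ∑-trim L zero _ z≤n = refl
    ∑-trim L (suc M) {f} tail L≤1+M with ℕ.m≤n⇒m<n∨m≡n L≤1+M
    ... | inj₂ ≡.refl = refl
    ... | inj₁ (s≤s L≤M) = begin
      ∑ (suc M) f  ≈⟨ ∑-suc M f ⟩
      ∑ M f ∙ f M  ≈⟨ ∙-cong (∑-trim L M tail L≤M) (tail M L≤M) ⟩
      ∑ L f ∙ ε    ≈⟨ identityʳ _ ⟩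
      ∑ L f        ∎

    ∑-bound-irrelevant : ∀ L L′ {f} → (∀ k → L ≤ k → f k ≈ ε) → (∀ k → L′ ≤ k → f k ≈ ε) →
                         ∑ L f ≈ ∑ L′ f
    ∑-bound-irrelevant L L′ tail tail′ with ℕ.≤-total L L′
    ... | inj₁ L≤L′ = sym (∑-trim L L′ tail L≤L′)
    ... | inj₂ L′≤L = ∑-trim L′ L tail′ L′≤L

    ∑-comm : ∀ n m (f : ℕ → ℕ → Carrier) →
             ∑ n (λ i → ∑ m (f i)) ≈ ∑ m (λ j → ∑ n (λ i → f i j))
    ∑-comm zero m f = begin
      ∑ 0 _             ≈⟨ ∑-zero _ ⟩
      ε                 ≈⟨ ∑-≈ε m (λ j _ → ∑-zero _) ⟨
      ∑ m (λ j → ∑ 0 _) ∎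
    ∑-comm (suc n) m f = begin
      ∑ (suc n) (λ i → ∑ m (f i))                          ≈⟨ ∑-suc n _ ⟩
      ∑ n (λ i → ∑ m (f i)) ∙ ∑ m (f n)                    ≈⟨ ∙-congʳ (∑-comm n m f) ⟩
      ∑ m (λ j → ∑ n (λ i → f i j)) ∙ ∑ m (f n)            ≈⟨ ∑-distrib-∙ m _ (f n) ⟨
      ∑ m (λ j → ∑ n (λ i → f i j) ∙ f n j)                ≈⟨ ∑-cong m (λ j → ∑-suc n _) ⟨
      ∑ m (λ j → ∑ (suc n) (λ i → f i j))                  ∎

    ∑-antidiagonal : ∀ M (G : ℕ → ℕ → Carrier) →
      ∑ M (λ k → ∑ (M ∸ k) (G k)) ≈ ∑ M (λ m → ∑ (suc m) (λ i → G i (m ∸ i)))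
    ∑-antidiagonal zero G = trans (∑-zero _) (sym (∑-zero _))
    ∑-antidiagonal (suc M) G = begin
      ∑ (suc M) (λ k → ∑ (suc M ∸ k) (G k))
        ≈⟨ ∑-shift M _ ⟩
      ∑ (suc M) (G 0) ∙ ∑ M (λ k → ∑ (M ∸ k) (G (suc k)))
        ≈⟨ ∙-congˡ (∑-antidiagonal M (λ k → G (suc k))) ⟩
      ∑ (suc M) (G 0) ∙ ∑ M (λ m → ∑ (suc m) (λ i → G (suc i) (m ∸ i)))
        ≈⟨ ∙-congˡ (identityˡ _) ⟨
      ∑ (suc M) (G 0) ∙ (ε ∙ ∑ M (λ m → ∑ (suc m) (λ i → G (suc i) (m ∸ i))))
        ≈⟨ ∙-congˡ (trans (∑-shift M (λ m → ∑ m (λ i → G (suc i) (m ∸ suc i))))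
                          (∙-congʳ (∑-zero _))) ⟨
      ∑ (suc M) (G 0) ∙ ∑ (suc M) (λ m → ∑ m (λ i → G (suc i) (m ∸ suc i)))
        ≈⟨ ∑-distrib-∙ (suc M) (G 0) _ ⟨
      ∑ (suc M) (λ m → G 0 m ∙ ∑ m (λ i → G (suc i) (m ∸ suc i)))
        ≈⟨ ∑-cong (suc M) (λ m → ∑-shift m (λ i → G i (m ∸ i))) ⟨
      ∑ (suc M) (λ m → ∑ (suc m) (λ i → G i (m ∸ i)))
        ∎

module UmbralCalculus {c ℓ} (F : CharZeroField c ℓ) where

  open CharZeroField F
  open Over F
  open import Algebra.Properties.Ring (CommutativeRing.ring commRing) using (-0#≈0#; -‿distribʳ-*)

  module _ where

    open SetoidReasoning setoid
    open import Algebra.Properties.Semiring.Mult semiring using (×-homo-+; ×1-homo-*) renaming (_×_ to _×ᴷ_)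

    fromℕ≡×1 : ∀ n → fromℕ n ≡ n ×ᴷ 1#
    fromℕ≡×1 zero    = ≡.refl
    fromℕ≡×1 (suc n) = ≡.cong (1# +_) (fromℕ≡×1 n)

    fromℕ-+ : ∀ m n → fromℕ (m ℕ.+ n) ≈ fromℕ m + fromℕ n
    fromℕ-+ m n rewrite fromℕ≡×1 (m ℕ.+ n) | fromℕ≡×1 m | fromℕ≡×1 n = ×-homo-+ 1# m n

    fromℕ-* : ∀ m n → fromℕ (m ℕ.* n) ≈ fromℕ m * fromℕ n
    fromℕ-* m n rewrite fromℕ≡×1 (m ℕ.* n) | fromℕ≡×1 m | fromℕ≡×1 n = ×1-homo-* m n

    fromℕ-1 : fromℕ 1 ≈ 1#
    fromℕ-1 = +-identityʳ 1#

    ⁻¹-unique : ∀ x y → ¬ (x ≈ 0#) → x * y ≈ 1# → y ≈ x ⁻¹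
    ⁻¹-unique x y x≉0 xy≈1 = begin
      y                ≈⟨ *-identityʳ y ⟨
      y * 1#           ≈⟨ *-congˡ (inverseʳ x x≉0) ⟨
      y * (x * x ⁻¹)   ≈⟨ *-assoc y x (x ⁻¹) ⟨
      (y * x) * x ⁻¹   ≈⟨ *-congʳ (trans (*-comm y x) xy≈1) ⟩
      1# * x ⁻¹        ≈⟨ *-identityˡ _ ⟩
      x ⁻¹             ∎

    fromℕ-cancelˡ : ∀ n {x y} → fromℕ (suc n) * x ≈ fromℕ (suc n) * y → x ≈ y
    fromℕ-cancelˡ n {x} {y} nx≈ny = begin
      x                          ≈⟨ *-identityˡ x ⟨
      1# * x                     ≈⟨ *-congʳ (k⁻¹k≈1) ⟨
      (k ⁻¹ * k) * x             ≈⟨ *-assoc _ _ _ ⟩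
      k ⁻¹ * (k * x)             ≈⟨ *-congˡ nx≈ny ⟩
      k ⁻¹ * (k * y)             ≈⟨ *-assoc _ _ _ ⟨
      (k ⁻¹ * k) * y             ≈⟨ *-congʳ (k⁻¹k≈1) ⟩
      1# * y                     ≈⟨ *-identityˡ y ⟩
      y                          ∎
      where
      k = fromℕ (suc n)
      k⁻¹k≈1 : k ⁻¹ * k ≈ 1#
      k⁻¹k≈1 = trans (*-comm _ _) (inverseʳ k (charZero n))

    fromℕ[n!]≉0 : ∀ n → ¬ (fromℕ (n !) ≈ 0#)
    fromℕ[n!]≉0 n with n ! | ℕ.1≤n! n
    ... | suc m | _ = charZero m

    inv!-0 : inv! 0 ≈ 1#
    inv!-0 = sym (⁻¹-unique (fromℕ 1) 1# (charZero 0) (trans (*-identityʳ _) fromℕ-1))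

    inv!-suc : ∀ j → fromℕ (suc j) * inv! (suc j) ≈ inv! j
    inv!-suc j = ⁻¹-unique (fromℕ (j !)) _ (fromℕ[n!]≉0 j) (begin
      fromℕ (j !) * (fromℕ (suc j) * inv! (suc j))  ≈⟨ *-assoc _ _ _ ⟨
      (fromℕ (j !) * fromℕ (suc j)) * inv! (suc j)  ≈⟨ *-congʳ (*-comm _ _) ⟩
      (fromℕ (suc j) * fromℕ (j !)) * inv! (suc j)  ≈⟨ *-congʳ (fromℕ-* (suc j) (j !)) ⟨
      fromℕ (suc j !) * inv! (suc j)                ≈⟨ inverseʳ _ (fromℕ[n!]≉0 (suc j)) ⟩
      1#                                            ∎)

  coeff-⊕ : ∀ p r i → coeff (p ⊕ r) i ≈ coeff p i + coeff r i
  coeff-⊕ []      r       i       = sym (+-identityˡ _)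
  coeff-⊕ (a ∷ p) []      i       = sym (+-identityʳ _)
  coeff-⊕ (a ∷ p) (b ∷ r) zero    = refl
  coeff-⊕ (a ∷ p) (b ∷ r) (suc i) = coeff-⊕ p r i

  coeff-· : ∀ a p i → coeff (a · p) i ≈ a * coeff p i
  coeff-· a []      i       = sym (zeroʳ a)
  coeff-· a (b ∷ p) zero    = refl
  coeff-· a (b ∷ p) (suc i) = coeff-· a p i

  coeff-⊖ : ∀ p i → coeff (⊖ p) i ≈ - coeff p i
  coeff-⊖ []      i       = sym -0#≈0#
  coeff-⊖ (a ∷ p) zero    = refl
  coeff-⊖ (a ∷ p) (suc i) = coeff-⊖ p i

  coeff-sumP : ∀ n f i → coeff (sumP n f) i ≈ sumK n (λ k → coeff (f k) i)
  coeff-sumP zero    f i = refl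
  coeff-sumP (suc n) f i = trans (coeff-⊕ (sumP n f) (f n) i) (+-congʳ (coeff-sumP n f i))

  coeff-DAux : ∀ k p i → coeff (DAux k p) i ≈ fromℕ (k ℕ.+ i) * coeff p i
  coeff-DAux k []      i       = sym (zeroʳ _)
  coeff-DAux k (a ∷ p) zero    = *-congʳ (reflexive (≡.cong fromℕ (≡.sym (ℕ.+-identityʳ k))))
  coeff-DAux k (a ∷ p) (suc i) =
    trans (coeff-DAux (suc k) p i) (*-congʳ (reflexive (≡.cong fromℕ (≡.sym (ℕ.+-suc k i)))))

  coeff-D : ∀ p i → coeff (Dop p) i ≈ fromℕ (suc i) * coeff p (suc i)
  coeff-D []      i = sym (zeroʳ _)
  coeff-D (a ∷ p) i = coeff-DAux 1 p i

  -- _≋_ wrapped in a record, so that both sides can be inferred from a proof.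
  infix 4 _≐_
  record _≐_ (p r : Poly) : Set ℓ where
    constructor ≋⇒≐
    field ≐⇒≋ : p ≋ r
  open _≐_ public

  ≐-refl : ∀ {p} → p ≐ p
  ≐-refl = ≋⇒≐ λ _ → refl

  ≐-reflexive : ∀ {p r} → p ≡ r → p ≐ r
  ≐-reflexive ≡.refl = ≐-refl

  ≐-sym : ∀ {p r} → p ≐ r → r ≐ p
  ≐-sym (≋⇒≐ e) = ≋⇒≐ λ i → sym (e i)

  ≐-trans : ∀ {p r s} → p ≐ r → r ≐ s → p ≐ s
  ≐-trans (≋⇒≐ e) (≋⇒≐ e′) = ≋⇒≐ λ i → trans (e i) (e′ i)

  ⊕-cong : ∀ {p p′ r r′} → p ≐ p′ → r ≐ r′ → (p ⊕ r) ≐ (p′ ⊕ r′)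
  ⊕-cong {p} {p′} {r} {r′} (≋⇒≐ e) (≋⇒≐ e′) = ≋⇒≐ λ i →
    trans (coeff-⊕ p r i) (trans (+-cong (e i) (e′ i)) (sym (coeff-⊕ p′ r′ i)))

  ⊕-congˡ : ∀ {p r r′} → r ≐ r′ → (p ⊕ r) ≐ (p ⊕ r′)
  ⊕-congˡ = ⊕-cong ≐-refl

  ⊕-congʳ : ∀ {p p′ r} → p ≐ p′ → (p ⊕ r) ≐ (p′ ⊕ r)
  ⊕-congʳ p≐p′ = ⊕-cong p≐p′ ≐-refl

  module _ where

    open SetoidReasoning setoid

    ⊕-assoc : ∀ p r s → ((p ⊕ r) ⊕ s) ≐ (p ⊕ (r ⊕ s))
    ⊕-assoc p r s = ≋⇒≐ λ i → begin
      coeff ((p ⊕ r) ⊕ s) i                ≈⟨ trans (coeff-⊕ (p ⊕ r) s i) (+-congʳ (coeff-⊕ p r i)) ⟩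
      (coeff p i + coeff r i) + coeff s i  ≈⟨ +-assoc _ _ _ ⟩
      coeff p i + (coeff r i + coeff s i)  ≈⟨ trans (coeff-⊕ p (r ⊕ s) i) (+-congˡ (coeff-⊕ r s i)) ⟨
      coeff (p ⊕ (r ⊕ s)) i                ∎

    ·-distribˡ : ∀ a p r → (a · (p ⊕ r)) ≐ ((a · p) ⊕ (a · r))
    ·-distribˡ a p r = ≋⇒≐ λ i → begin
      coeff (a · (p ⊕ r)) i            ≈⟨ trans (coeff-· a (p ⊕ r) i) (*-congˡ (coeff-⊕ p r i)) ⟩
      a * (coeff p i + coeff r i)      ≈⟨ distribˡ _ _ _ ⟩
      a * coeff p i + a * coeff r i    ≈⟨ trans (coeff-⊕ (a · p) (a · r) i) (+-cong (coeff-· a p i) (coeff-· a r i)) ⟨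
      coeff ((a · p) ⊕ (a · r)) i      ∎

    ·-distribʳ : ∀ a b p → ((a + b) · p) ≐ ((a · p) ⊕ (b · p))
    ·-distribʳ a b p = ≋⇒≐ λ i → begin
      coeff ((a + b) · p) i            ≈⟨ coeff-· (a + b) p i ⟩
      (a + b) * coeff p i              ≈⟨ distribʳ _ _ _ ⟩
      a * coeff p i + b * coeff p i    ≈⟨ trans (coeff-⊕ (a · p) (b · p) i) (+-cong (coeff-· a p i) (coeff-· b p i)) ⟨
      coeff ((a · p) ⊕ (b · p)) i      ∎

    ·-assoc : ∀ a b p → ((a * b) · p) ≐ (a · (b · p))
    ·-assoc a b p = ≋⇒≐ λ i → begin
      coeff ((a * b) · p) i    ≈⟨ coeff-· (a * b) p i ⟩
      (a * b) * coeff p i      ≈⟨ *-assoc _ _ _ ⟩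
      a * (b * coeff p i)      ≈⟨ trans (coeff-· a (b · p) i) (*-congˡ (coeff-· b p i)) ⟨
      coeff (a · (b · p)) i    ∎

    ⊖-· : ∀ a p → (⊖ (a · p)) ≐ (a · (⊖ p))
    ⊖-· a p = ≋⇒≐ λ i → begin
      coeff (⊖ (a · p)) i    ≈⟨ trans (coeff-⊖ (a · p) i) (-‿cong (coeff-· a p i)) ⟩
      - (a * coeff p i)      ≈⟨ -‿distribʳ-* _ _ ⟩
      a * - coeff p i        ≈⟨ trans (coeff-· a (⊖ p) i) (*-congˡ (coeff-⊖ p i)) ⟨
      coeff (a · (⊖ p)) i    ∎

    D-⊕ : ∀ p r → Dop (p ⊕ r) ≐ (Dop p ⊕ Dop r)
    D-⊕ p r = ≋⇒≐ λ i → begin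
      coeff (Dop (p ⊕ r)) i
        ≈⟨ trans (coeff-D (p ⊕ r) i) (*-congˡ (coeff-⊕ p r (suc i))) ⟩
      fromℕ (suc i) * (coeff p (suc i) + coeff r (suc i))
        ≈⟨ distribˡ _ _ _ ⟩
      fromℕ (suc i) * coeff p (suc i) + fromℕ (suc i) * coeff r (suc i)
        ≈⟨ trans (coeff-⊕ (Dop p) (Dop r) i) (+-cong (coeff-D p i) (coeff-D r i)) ⟨
      coeff (Dop p ⊕ Dop r) i
        ∎

    D-· : ∀ a p → Dop (a · p) ≐ (a · Dop p)
    D-· a p = ≋⇒≐ λ i → begin
      coeff (Dop (a · p)) i                 ≈⟨ trans (coeff-D (a · p) i) (*-congˡ (coeff-· a p (suc i))) ⟩
      fromℕ (suc i) * (a * coeff p (suc i)) ≈⟨ x∙yz≈y∙xz _ _ _ ⟩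
      a * (fromℕ (suc i) * coeff p (suc i)) ≈⟨ trans (coeff-· a (Dop p) i) (*-congˡ (coeff-D p i)) ⟨
      coeff (a · Dop p) i                   ∎
      where open CommutativeSemigroupProperties *-commutativeSemigroup using (x∙yz≈y∙xz)

    D-xhat : ∀ r → Dop (xhat r) ≐ (xhat (Dop r) ⊕ r)
    D-xhat r = ≋⇒≐ λ
      { zero    → begin
          coeff (Dop (xhat r)) 0      ≈⟨ coeff-D (xhat r) 0 ⟩
          fromℕ 1 * coeff r 0         ≈⟨ trans (*-congʳ fromℕ-1) (*-identityˡ _) ⟩
          coeff r 0                   ≈⟨ +-identityˡ _ ⟨
          0# + coeff r 0              ≈⟨ coeff-⊕ (xhat (Dop r)) r 0 ⟨
          coeff (xhat (Dop r) ⊕ r) 0  ∎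
      ; (suc i) → begin
          coeff (Dop (xhat r)) (suc i)                            ≈⟨ coeff-D (xhat r) (suc i) ⟩
          (1# + fromℕ (suc i)) * coeff r (suc i)                  ≈⟨ distribʳ _ _ _ ⟩
          1# * coeff r (suc i) + fromℕ (suc i) * coeff r (suc i)  ≈⟨ +-cong (*-identityˡ _) (sym (coeff-D r i)) ⟩
          coeff r (suc i) + coeff (Dop r) i                       ≈⟨ +-comm _ _ ⟩
          coeff (Dop r) i + coeff r (suc i)                       ≈⟨ coeff-⊕ (xhat (Dop r)) r (suc i) ⟨
          coeff (xhat (Dop r) ⊕ r) (suc i)                        ∎ }

  D-cong : ∀ {p r} → p ≐ r → Dop p ≐ Dop r
  D-cong {p} {r} (≋⇒≐ e) = ≋⇒≐ λ i → trans (coeff-D p i) (trans (*-congˡ (e (suc i))) (sym (coeff-D r i)))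

  ⊕-comm : ∀ p r → (p ⊕ r) ≐ (r ⊕ p)
  ⊕-comm p r = ≋⇒≐ λ i → trans (coeff-⊕ p r i) (trans (+-comm _ _) (sym (coeff-⊕ r p i)))

  ⊕-identityʳ : ∀ p → (p ⊕ []) ≐ p
  ⊕-identityʳ p = ≋⇒≐ λ i → trans (coeff-⊕ p [] i) (+-identityʳ _)

  ⊖-cong : ∀ {p r} → p ≐ r → (⊖ p) ≐ (⊖ r)
  ⊖-cong {p} {r} (≋⇒≐ e) = ≋⇒≐ λ i → trans (coeff-⊖ p i) (trans (-‿cong (e i)) (sym (coeff-⊖ r i)))

  ⊕-inverseʳ : ∀ p → (p ⊕ (⊖ p)) ≐ []
  ⊕-inverseʳ p = ≋⇒≐ λ i → trans (coeff-⊕ p (⊖ p) i) (trans (+-congˡ (coeff-⊖ p i)) (-‿inverseʳ _))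

  ⊕-⊖-abelianGroup : AbelianGroup c ℓ
  ⊕-⊖-abelianGroup = record
    { Carrier = Poly ; _≈_ = _≐_ ; _∙_ = _⊕_ ; ε = [] ; _⁻¹ = ⊖_
    ; isAbelianGroup = record
      { isGroup = record
        { isMonoid = record
          { isSemigroup = record
            { isMagma = record
              { isEquivalence = record { refl = ≐-refl ; sym = ≐-sym ; trans = ≐-trans }
              ; ∙-cong = ⊕-cong }
            ; assoc = ⊕-assoc }
          ; identity = (λ _ → ≐-refl) , ⊕-identityʳ }
        ; inverse = (λ p → ≐-trans (⊕-comm (⊖ p) p) (⊕-inverseʳ p)) , ⊕-inverseʳ
        ; ⁻¹-cong = ⊖-cong }
      ; comm = ⊕-comm } }

  open AbelianGroup ⊕-⊖-abelianGroup public
    using ()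
    renaming (setoid to ≐-setoid; commutativeMonoid to ⊕-commutativeMonoid)
  open AbelianGroupProperties ⊕-⊖-abelianGroup
    using (⁻¹-∙-comm; xyx⁻¹≈y; ∙-cancelˡ; inverseʳ-unique; \\-leftDividesʳ)
  open CommutativeSemigroupProperties (CommutativeMonoid.commutativeSemigroup ⊕-commutativeMonoid)
    using (interchange)

  open SetoidReasoning ≐-setoid

  ⊕-⊖-cancel : ∀ p r → (p ⊕ (r ⊕ (⊖ p))) ≐ r
  ⊕-⊖-cancel p r = ≐-trans (≐-sym (⊕-assoc p r (⊖ p))) (xyx⁻¹≈y p r)

  module ∑P = SumsIn.FiniteSums ⊕-commutativeMonoid sumP (λ _ → ≐-refl) (λ _ _ → ≐-refl)
  module ∑K = SumsIn.FiniteSums +-commutativeMonoid sumK (λ _ → refl) (λ _ _ → refl)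

  ·-cong : ∀ {a b p r} → a ≈ b → p ≐ r → (a · p) ≐ (b · r)
  ·-cong {a} {b} {p} {r} a≈b (≋⇒≐ e) = ≋⇒≐ λ i →
    trans (coeff-· a p i) (trans (*-cong a≈b (e i)) (sym (coeff-· b r i)))

  ·-congˡ : ∀ {a p r} → p ≐ r → (a · p) ≐ (a · r)
  ·-congˡ = ·-cong refl

  ·-comm : ∀ a b p → (a · (b · p)) ≐ (b · (a · p))
  ·-comm a b p = begin
    a · (b · p)    ≈⟨ ·-assoc a b p ⟨
    (a * b) · p    ≈⟨ ·-cong (*-comm a b) ≐-refl ⟩
    (b * a) · p    ≈⟨ ·-assoc b a p ⟩
    b · (a · p)    ∎

  ·-identityˡ : ∀ p → (1# · p) ≐ p
  ·-identityˡ p = ≋⇒≐ λ i → trans (coeff-· 1# p i) (*-identityˡ _)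

  ·-zeroˡ : ∀ {a} p → a ≈ 0# → (a · p) ≐ []
  ·-zeroˡ {a} p a≈0 = ≋⇒≐ λ i → trans (coeff-· a p i) (trans (*-congʳ a≈0) (zeroˡ _))

  ·-zeroʳ : ∀ a {p} → p ≐ [] → (a · p) ≐ []
  ·-zeroʳ a p≐[] = ·-congˡ p≐[]

  fromℕ1· : ∀ p → (fromℕ 1 · p) ≐ p
  fromℕ1· p = ≐-trans (·-cong fromℕ-1 ≐-refl) (·-identityˡ p)

  ·-sumP : ∀ a n f → (a · sumP n f) ≐ sumP n (λ k → a · f k)
  ·-sumP a zero    f = ≐-refl
  ·-sumP a (suc n) f = ≐-trans (·-distribˡ a (sumP n f) (f n)) (⊕-congʳ (·-sumP a n f))

  sumK-· : ∀ n g p → (sumK n g · p) ≐ sumP n (λ k → g k · p)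
  sumK-· zero    g p = ·-zeroˡ p refl
  sumK-· (suc n) g p = ≐-trans (·-distribʳ (sumK n g) (g n) p) (⊕-congʳ (sumK-· n g p))

  xhat-cong : ∀ {p r} → p ≐ r → xhat p ≐ xhat r
  xhat-cong (≋⇒≐ e) = ≋⇒≐ λ { zero → refl ; (suc i) → e i }

  xhat-⊕ : ∀ p r → xhat (p ⊕ r) ≐ (xhat p ⊕ xhat r)
  xhat-⊕ p r = ≋⇒≐ λ { zero → sym (+-identityʳ 0#) ; (suc i) → refl }

  xhat-· : ∀ a p → xhat (a · p) ≐ (a · xhat p)
  xhat-· a p = ≋⇒≐ λ { zero → sym (zeroʳ a) ; (suc i) → refl }

  xhat-[] : xhat [] ≐ []
  xhat-[] = ≋⇒≐ λ { zero → refl ; (suc i) → refl }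

  record IsLinear (T : Op) : Set (c ⊔ ℓ) where
    field
      cong   : ∀ {p r} → p ≐ r → T p ≐ T r
      ⊕-homo : ∀ p r → T (p ⊕ r) ≐ (T p ⊕ T r)
      ·-homo : ∀ a p → T (a · p) ≐ (a · T p)

    []-homo : T [] ≐ []
    []-homo = ≐-trans (·-homo 0# []) (·-zeroˡ (T []) refl)

    ∑-homo : ∀ n f → T (sumP n f) ≐ sumP n (λ k → T (f k))
    ∑-homo zero    f = []-homo
    ∑-homo (suc n) f = ≐-trans (⊕-homo (sumP n f) (f n)) (⊕-congʳ (∑-homo n f))

    ⊖-homo : ∀ p → T (⊖ p) ≐ (⊖ T p)
    ⊖-homo p = inverseʳ-unique (T p) (T (⊖ p)) (begin
      T p ⊕ T (⊖ p)  ≈⟨ ⊕-homo p (⊖ p) ⟨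
      T (p ⊕ (⊖ p))  ≈⟨ cong (⊕-inverseʳ p) ⟩
      T []           ≈⟨ []-homo ⟩
      []             ∎)

  open IsLinear public

  isLinear-id : IsLinear idOp
  isLinear-id = record { cong = λ e → e ; ⊕-homo = λ _ _ → ≐-refl ; ·-homo = λ _ _ → ≐-refl }

  isLinear-∘ : ∀ {S T} → IsLinear S → IsLinear T → IsLinear (S ∘O T)
  isLinear-∘ {S} {T} S-lin T-lin = record
    { cong   = λ e → cong S-lin (cong T-lin e)
    ; ⊕-homo = λ p r → ≐-trans (cong S-lin (⊕-homo T-lin p r)) (⊕-homo S-lin (T p) (T r))
    ; ·-homo = λ a p → ≐-trans (cong S-lin (·-homo T-lin a p)) (·-homo S-lin a (T p)) }

  isLinear-iter : ∀ {T} → IsLinear T → ∀ k → IsLinear (iter k T)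
  isLinear-iter T-lin zero    = isLinear-id
  isLinear-iter T-lin (suc k) = isLinear-∘ T-lin (isLinear-iter T-lin k)

  isLinear-≐ : ∀ {S T} → (∀ p → S p ≐ T p) → IsLinear T → IsLinear S
  isLinear-≐ {S} {T} S≐T T-lin = record
    { cong   = λ {p} {r} e → ≐-trans (S≐T p) (≐-trans (cong T-lin e) (≐-sym (S≐T r)))
    ; ⊕-homo = λ p r → ≐-trans (S≐T (p ⊕ r))
                         (≐-trans (⊕-homo T-lin p r) (⊕-cong (≐-sym (S≐T p)) (≐-sym (S≐T r))))
    ; ·-homo = λ a p → ≐-trans (S≐T (a · p)) (≐-trans (·-homo T-lin a p) (·-congˡ (≐-sym (S≐T p)))) }

  isLinear-xhat : IsLinear xhat
  isLinear-xhat = record { cong = xhat-cong ; ⊕-homo = xhat-⊕ ; ·-homo = xhat-· }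

  isLinear-xhatᵏ : ∀ k → IsLinear (iter k xhat)
  isLinear-xhatᵏ = isLinear-iter isLinear-xhat

  isLinear-· : ∀ a {T} → IsLinear T → IsLinear (λ p → a · T p)
  isLinear-· a T-lin = isLinear-∘ (record { cong = ·-congˡ ; ⊕-homo = ·-distribˡ a ; ·-homo = ·-comm a })
                                  T-lin

  isLinear-∑ : ∀ n {T : ℕ → Op} → (∀ k → IsLinear (T k)) → IsLinear (λ p → sumP n (λ k → T k p))
  isLinear-∑ zero    T-lin =
    record { cong = λ _ → ≐-refl ; ⊕-homo = λ _ _ → ≐-refl ; ·-homo = λ _ _ → ≐-refl }
  isLinear-∑ (suc n) {T} T-lin = record
    { cong   = λ e → ⊕-cong (cong ∑-lin e) (cong (T-lin n) e)
    ; ⊕-homo = λ p r → ≐-trans (⊕-cong (⊕-homo ∑-lin p r) (⊕-homo (T-lin n) p r))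
                         (interchange (sumP n (λ k → T k p)) (sumP n (λ k → T k r)) (T n p) (T n r))
    ; ·-homo = λ a p → ≐-trans (⊕-cong (·-homo ∑-lin a p) (·-homo (T-lin n) a p))
                         (≐-sym (·-distribˡ a (sumP n (λ k → T k p)) (T n p))) }
    where ∑-lin = isLinear-∑ n T-lin

  iter-suc : ∀ k T p → iter k T (T p) ≡ T (iter k T p)
  iter-suc zero    T p = ≡.refl
  iter-suc (suc k) T p = ≡.cong T (iter-suc k T p)

  iter-+ : ∀ k j T p → iter k T (iter j T p) ≡ iter (k ℕ.+ j) T p
  iter-+ zero    j T p = ≡.refl
  iter-+ (suc k) j T p = ≡.cong T (iter-+ k j T p)

  iter-≐ : ∀ {S T} → (∀ p → S p ≐ T p) → IsLinear T → ∀ k p → iter k S p ≐ iter k T p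
  iter-≐ S≐T T-lin zero    p = ≐-refl
  iter-≐ S≐T T-lin (suc k) p = ≐-trans (S≐T _) (cong T-lin (iter-≐ S≐T T-lin k p))

  record DegreeBelow (L : ℕ) (p : Poly) : Set ℓ where
    constructor degreeBelow
    field vanishes : ∀ i → L ≤ i → coeff p i ≈ 0#
  open DegreeBelow public

  degreeBelow-length : ∀ p → DegreeBelow (length p) p
  degreeBelow-length p = degreeBelow (vanish p)
    where
    vanish : ∀ p i → length p ≤ i → coeff p i ≈ 0#
    vanish []      i       _         = refl
    vanish (a ∷ p) (suc i) (s≤s p≤i) = vanish p i p≤i

  degreeBelow-0 : ∀ {p} → DegreeBelow 0 p → p ≐ []
  degreeBelow-0 d = ≋⇒≐ λ i → vanishes d i z≤n

  ≐[]⇒degreeBelow : ∀ {L p} → p ≐ [] → DegreeBelow L p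
  ≐[]⇒degreeBelow (≋⇒≐ e) = degreeBelow λ i _ → e i

  degreeBelow-mono : ∀ {L L′ p} → L ≤ L′ → DegreeBelow L p → DegreeBelow L′ p
  degreeBelow-mono L≤L′ d = degreeBelow λ i L′≤i → vanishes d i (ℕ.≤-trans L≤L′ L′≤i)

  degreeBelow-≐ : ∀ {L p r} → p ≐ r → DegreeBelow L p → DegreeBelow L r
  degreeBelow-≐ (≋⇒≐ e) d = degreeBelow λ i L≤i → trans (sym (e i)) (vanishes d i L≤i)

  degreeBelow-⊕ : ∀ {L p r} → DegreeBelow L p → DegreeBelow L r → DegreeBelow L (p ⊕ r)
  degreeBelow-⊕ {p = p} {r} d d′ = degreeBelow λ i L≤i →
    trans (coeff-⊕ p r i) (trans (+-cong (vanishes d i L≤i) (vanishes d′ i L≤i)) (+-identityʳ 0#))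

  degreeBelow-· : ∀ {L} a {p} → DegreeBelow L p → DegreeBelow L (a · p)
  degreeBelow-· a {p} d = degreeBelow λ i L≤i →
    trans (coeff-· a p i) (trans (*-congˡ (vanishes d i L≤i)) (zeroʳ a))

  degreeBelow-∑ : ∀ {L} n {f} → (∀ k → k < n → DegreeBelow L (f k)) → DegreeBelow L (sumP n f)
  degreeBelow-∑ n {f} d = degreeBelow λ i L≤i →
    trans (coeff-sumP n f i) (∑K.∑-≈ε n (λ k k<n → vanishes (d k k<n) i L≤i))

  degreeBelow-xhat : ∀ {L p} → DegreeBelow L p → DegreeBelow (suc L) (xhat p)
  degreeBelow-xhat d = degreeBelow λ { (suc i) (s≤s L≤i) → vanishes d i L≤i }

  record IsLowering (T : Op) : Set (c ⊔ ℓ) where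
    field
      linear : IsLinear T
      lowers : ∀ {L p} → DegreeBelow (suc L) p → DegreeBelow L (T p)

    preserves : ∀ {L p} → DegreeBelow L p → DegreeBelow L (T p)
    preserves d = lowers (degreeBelow-mono (ℕ.n≤1+n _) d)

    iter-preserves : ∀ k {L p} → DegreeBelow L p → DegreeBelow L (iter k T p)
    iter-preserves zero    d = d
    iter-preserves (suc k) d = preserves (iter-preserves k d)

    iter-lowers : ∀ k {m p} → DegreeBelow (k ℕ.+ m) p → DegreeBelow m (iter k T p)
    iter-lowers zero            d = d
    iter-lowers (suc k) {p = p} d = degreeBelow-≐ (≐-reflexive (iter-suc k T p)) (iter-lowers k (lowers d))

    iter-annihilates : ∀ k {L p} → DegreeBelow L p → L ≤ k → iter k T p ≐ []
    iter-annihilates k d L≤k = degreeBelow-0 (iter-lowers k (degreeBelow-mono (ℕ.≤-trans L≤k (ℕ.m≤m+n k 0)) d))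

  open IsLowering public

  isLowering-≐ : ∀ {S T} → (∀ p → S p ≐ T p) → IsLowering T → IsLowering S
  isLowering-≐ S≐T T-low = record
    { linear = isLinear-≐ S≐T (linear T-low)
    ; lowers = λ {p = p} d → degreeBelow-≐ (≐-sym (S≐T p)) (lowers T-low d) }

  module PowerSeriesOf {T : Op} (T-low : IsLowering T) where

    T-lin : IsLinear T
    T-lin = linear T-low

    evalUpTo : ℕ → Series → Op
    evalUpTo M f p = sumP M (λ k → f k · iter k T p)

    evalAt-truncate : ∀ M f {p} → DegreeBelow M p → evalAt f T p ≐ evalUpTo M f p
    evalAt-truncate M f {p} d = ∑P.∑-bound-irrelevant (suc (length p)) M
      (λ k len<k → ·-zeroʳ (f k) (iter-annihilates T-low k (degreeBelow-length p) (ℕ.<⇒≤ len<k)))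
      (λ k M≤k → ·-zeroʳ (f k) (iter-annihilates T-low k d M≤k))

    isLinear-evalUpTo : ∀ M f → IsLinear (evalUpTo M f)
    isLinear-evalUpTo M f = isLinear-∑ M (λ k → isLinear-· (f k) (isLinear-iter T-lin k))

    isLinear-evalAt : ∀ f → IsLinear (evalAt f T)
    isLinear-evalAt f = record { cong = evalAt-cong ; ⊕-homo = evalAt-⊕ ; ·-homo = evalAt-· }
      where
      evalAt-cong : ∀ {p r} → p ≐ r → evalAt f T p ≐ evalAt f T r
      evalAt-cong {p} {r} p≐r = begin
        evalAt f T p            ≈⟨ evalAt-truncate M f (degreeBelow-length p) ⟩
        evalUpTo M f p          ≈⟨ cong (isLinear-evalUpTo M f) p≐r ⟩
        evalUpTo M f r          ≈⟨ evalAt-truncate M f (degreeBelow-≐ p≐r (degreeBelow-length p)) ⟨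
        evalAt f T r            ∎
        where M = length p
      evalAt-⊕ : ∀ p r → evalAt f T (p ⊕ r) ≐ (evalAt f T p ⊕ evalAt f T r)
      evalAt-⊕ p r = begin
        evalAt f T (p ⊕ r)                ≈⟨ evalAt-truncate M f (degreeBelow-⊕ dp dr) ⟩
        evalUpTo M f (p ⊕ r)              ≈⟨ ⊕-homo (isLinear-evalUpTo M f) p r ⟩
        evalUpTo M f p ⊕ evalUpTo M f r   ≈⟨ ⊕-cong (evalAt-truncate M f dp) (evalAt-truncate M f dr) ⟨
        evalAt f T p ⊕ evalAt f T r       ∎
        where
        M = length p ℕ.+ length r
        dp = degreeBelow-mono (ℕ.m≤m+n (length p) (length r)) (degreeBelow-length p)
        dr = degreeBelow-mono (ℕ.m≤n+m (length r) (length p)) (degreeBelow-length r)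
      evalAt-· : ∀ a p → evalAt f T (a · p) ≐ (a · evalAt f T p)
      evalAt-· a p = begin
        evalAt f T (a · p)     ≈⟨ evalAt-truncate M f (degreeBelow-· a (degreeBelow-length p)) ⟩
        evalUpTo M f (a · p)   ≈⟨ ·-homo (isLinear-evalUpTo M f) a p ⟩
        a · evalUpTo M f p     ≈⟨ ·-congˡ (evalAt-truncate M f (degreeBelow-length p)) ⟨
        a · evalAt f T p       ∎
        where M = length p

    evalAt-preserves : ∀ f {L p} → DegreeBelow L p → DegreeBelow L (evalAt f T p)
    evalAt-preserves f {p = p} d =
      degreeBelow-∑ (suc (length p)) (λ k _ → degreeBelow-· (f k) (iter-preserves T-low k d))

    isLowering-evalAt : ∀ f → f 0 ≈ 0# → IsLowering (evalAt f T)
    isLowering-evalAt f f₀≈0 = record { linear = isLinear-evalAt f ; lowers = lowers′ }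
      where
      lowers′ : ∀ {L p} → DegreeBelow (suc L) p → DegreeBelow L (evalAt f T p)
      lowers′ {p = p} d = degreeBelow-∑ (suc (length p)) λ
        { zero    _ → ≐[]⇒degreeBelow (·-zeroˡ p f₀≈0)
        ; (suc k) _ → degreeBelow-· (f (suc k)) (lowers T-low (iter-preserves T-low k d)) }

    evalAt-≈S : ∀ {f h} → f ≈S h → ∀ p → evalAt f T p ≐ evalAt h T p
    evalAt-≈S f≈h p = ∑P.∑-cong (suc (length p)) (λ k → ·-cong (f≈h k) ≐-refl)

    evalAt-oneS : ∀ p → evalAt oneS T p ≐ p
    evalAt-oneS p = begin
      evalAt oneS T p
        ≈⟨ ∑P.∑-shift (length p) _ ⟩
      (1# · p) ⊕ sumP (length p) (λ k → 0# · iter (suc k) T p)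
        ≈⟨ ⊕-cong (·-identityˡ p) (∑P.∑-≈ε (length p) (λ k _ → ·-zeroˡ _ refl)) ⟩
      p ⊕ []
        ≈⟨ ⊕-identityʳ p ⟩
      p ∎

    evalAt-tS : ∀ p → evalAt tS T p ≐ T p
    evalAt-tS p = begin
      evalAt tS T p
        ≈⟨ evalAt-truncate (2 ℕ.+ M) tS (degreeBelow-mono (ℕ.m≤n+m M 2) (degreeBelow-length p)) ⟩
      evalUpTo (2 ℕ.+ M) tS p
        ≈⟨ ∑P.∑-shift (suc M) _ ⟩
      (0# · p) ⊕ sumP (suc M) (λ k → tS (suc k) · iter (suc k) T p)
        ≈⟨ ⊕-cong (·-zeroˡ p refl) (∑P.∑-shift M _) ⟩
      [] ⊕ ((1# · T p) ⊕ sumP M (λ k → 0# · iter (2 ℕ.+ k) T p))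
        ≈⟨ ⊕-cong (·-identityˡ (T p)) (∑P.∑-≈ε M (λ k _ → ·-zeroˡ _ refl)) ⟩
      T p ⊕ []
        ≈⟨ ⊕-identityʳ (T p) ⟩
      T p ∎
      where M = length p

    evalAt-evalAt : ∀ f h p → evalAt f T (evalAt h T p) ≐
                    sumP (length p) (λ k → sumP (length p) (λ j → (f k * h j) · iter (k ℕ.+ j) T p))
    evalAt-evalAt f h p = begin
      evalAt f T (evalAt h T p)
        ≈⟨ evalAt-truncate M f (evalAt-preserves h (degreeBelow-length p)) ⟩
      evalUpTo M f (evalAt h T p)
        ≈⟨ cong (isLinear-evalUpTo M f) (evalAt-truncate M h (degreeBelow-length p)) ⟩
      sumP M (λ k → f k · iter k T (evalUpTo M h p))
        ≈⟨ ∑P.∑-cong M term ⟩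
      sumP M (λ k → sumP M (λ j → (f k * h j) · iter (k ℕ.+ j) T p)) ∎
      where
      M = length p
      term : ∀ k → (f k · iter k T (evalUpTo M h p)) ≐ sumP M (λ j → (f k * h j) · iter (k ℕ.+ j) T p)
      term k = begin
        f k · iter k T (evalUpTo M h p)
          ≈⟨ ·-congˡ (∑-homo Tᵏ-lin M _) ⟩
        f k · sumP M (λ j → iter k T (h j · iter j T p))
          ≈⟨ ·-sumP (f k) M _ ⟩
        sumP M (λ j → f k · iter k T (h j · iter j T p))
          ≈⟨ ∑P.∑-cong M (λ j → ·-congˡ (·-homo Tᵏ-lin (h j) _)) ⟩
        sumP M (λ j → f k · (h j · iter k T (iter j T p)))
          ≈⟨ ∑P.∑-cong M (λ j → ≐-sym (·-assoc (f k) (h j) _)) ⟩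
        sumP M (λ j → (f k * h j) · iter k T (iter j T p))
          ≈⟨ ∑P.∑-cong M (λ j → ·-congˡ (≐-reflexive (iter-+ k j T p))) ⟩
        sumP M (λ j → (f k * h j) · iter (k ℕ.+ j) T p) ∎
        where Tᵏ-lin = isLinear-iter T-lin k

    evalAt-comm : ∀ f h p → evalAt f T (evalAt h T p) ≐ evalAt h T (evalAt f T p)
    evalAt-comm f h p = begin
      evalAt f T (evalAt h T p)
        ≈⟨ evalAt-evalAt f h p ⟩
      sumP M (λ k → sumP M (λ j → (f k * h j) · iter (k ℕ.+ j) T p))
        ≈⟨ ∑P.∑-comm M M _ ⟩
      sumP M (λ j → sumP M (λ k → (f k * h j) · iter (k ℕ.+ j) T p))
        ≈⟨ ∑P.∑-cong M (λ j → ∑P.∑-cong M (λ k → swap k j)) ⟩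
      sumP M (λ j → sumP M (λ k → (h j * f k) · iter (j ℕ.+ k) T p))
        ≈⟨ evalAt-evalAt h f p ⟨
      evalAt h T (evalAt f T p) ∎
      where
      M = length p
      swap : ∀ k j → ((f k * h j) · iter (k ℕ.+ j) T p) ≐ ((h j * f k) · iter (j ℕ.+ k) T p)
      swap k j = ·-cong (*-comm (f k) (h j)) (≐-reflexive (≡.cong (λ n → iter n T p) (ℕ.+-comm k j)))

    evalAt-mulS : ∀ f h p → evalAt f T (evalAt h T p) ≐ evalAt (mulS f h) T p
    evalAt-mulS f h p = begin
      evalAt f T (evalAt h T p)
        ≈⟨ evalAt-evalAt f h p ⟩
      sumP M (λ k → sumP M (G k))
        ≈⟨ ∑P.∑-cong M (λ k → ∑P.∑-trim (M ∸ k) M (G-vanishes k) (ℕ.m∸n≤m M k)) ⟩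
      sumP M (λ k → sumP (M ∸ k) (G k))
        ≈⟨ ∑P.∑-antidiagonal M G ⟩
      sumP M (λ m → sumP (suc m) (λ i → G i (m ∸ i)))
        ≈⟨ ∑P.∑-cong M (λ m → ∑P.∑-cong< (suc m) (λ i i≤m → ·-congˡ (≐-reflexive (i+[m∸i] i≤m)))) ⟩
      sumP M (λ m → sumP (suc m) (λ i → (f i * h (m ∸ i)) · iter m T p))
        ≈⟨ ∑P.∑-cong M (λ m → ≐-sym (sumK-· (suc m) _ _)) ⟩
      evalUpTo M (mulS f h) p
        ≈⟨ evalAt-truncate M (mulS f h) (degreeBelow-length p) ⟨
      evalAt (mulS f h) T p ∎
      where
      M = length p
      G : ℕ → ℕ → Poly
      G k j = (f k * h j) · iter (k ℕ.+ j) T p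
      G-vanishes : ∀ k j → M ∸ k ≤ j → G k j ≐ []
      G-vanishes k j M∸k≤j = ·-zeroʳ _ (iter-annihilates T-low (k ℕ.+ j) (degreeBelow-length p)
                               (ℕ.≤-trans (ℕ.m≤n+m∸n M k) (ℕ.+-monoʳ-≤ k M∸k≤j)))
      i+[m∸i] : ∀ {i m} → i < suc m → iter (i ℕ.+ (m ∸ i)) T p ≡ iter m T p
      i+[m∸i] (s≤s i≤m) = ≡.cong (λ n → iter n T p) (ℕ.m+[n∸m]≡n i≤m)

    T-evalAt : ∀ f p → T (evalAt f T p) ≐ evalAt f T (T p)
    T-evalAt f p = begin
      T (evalAt f T p)            ≈⟨ evalAt-tS (evalAt f T p) ⟨
      evalAt tS T (evalAt f T p)  ≈⟨ evalAt-comm tS f p ⟩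
      evalAt f T (evalAt tS T p)  ≈⟨ cong (isLinear-evalAt f) (evalAt-tS p) ⟩
      evalAt f T (T p)            ∎

    xhat-evalAt : ∀ f r →
      xhat (evalAt f T r) ≐ ((f 0 · xhat r) ⊕ sumP (length r) (λ k → f (suc k) · xhat (iter (suc k) T r)))
    xhat-evalAt f r = begin
      xhat (evalAt f T r)
        ≈⟨ xhat-cong (evalAt-truncate (suc L) f (degreeBelow-mono (ℕ.n≤1+n L) (degreeBelow-length r))) ⟩
      xhat (evalUpTo (suc L) f r)
        ≈⟨ xhat-cong (∑P.∑-shift L _) ⟩
      xhat ((f 0 · r) ⊕ sumP L (λ k → f (suc k) · iter (suc k) T r))
        ≈⟨ xhat-⊕ (f 0 · r) _ ⟩
      xhat (f 0 · r) ⊕ xhat (sumP L (λ k → f (suc k) · iter (suc k) T r))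
        ≈⟨ ⊕-congˡ (∑-homo isLinear-xhat L _) ⟩
      xhat (f 0 · r) ⊕ sumP L (λ k → xhat (f (suc k) · iter (suc k) T r))
        ≈⟨ ⊕-cong (xhat-· (f 0) r) (∑P.∑-cong L (λ k → xhat-· _ _)) ⟩
      (f 0 · xhat r) ⊕ sumP L (λ k → f (suc k) · xhat (iter (suc k) T r)) ∎
      where L = length r

    module Commutator {S : Op} (S-lin : IsLinear S)
                      (S-preserves : ∀ {L p} → DegreeBelow L p → DegreeBelow L (S p))
                      (T-xhat : ∀ r → T (xhat r) ≐ (xhat (T r) ⊕ S r))
                      (S-T : ∀ r → S (T r) ≐ T (S r)) where

      S-iter : ∀ k r → S (iter k T r) ≐ iter k T (S r)
      S-iter zero    r = ≐-refl
      S-iter (suc k) r = ≐-trans (S-T (iter k T r)) (cong T-lin (S-iter k r))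

      iter-xhat : ∀ k r → iter (suc k) T (xhat r) ≐ (xhat (iter (suc k) T r) ⊕ (fromℕ (suc k) · iter k T (S r)))
      iter-xhat zero    r = ≐-trans (T-xhat r) (⊕-congˡ {p = xhat (T r)} (≐-sym (fromℕ1· (S r))))
      iter-xhat (suc k) r = begin
        T (iter (suc k) T (xhat r))               ≈⟨ cong T-lin (iter-xhat k r) ⟩
        T (xhat A ⊕ (n · B))                      ≈⟨ ⊕-homo T-lin _ _ ⟩
        T (xhat A) ⊕ T (n · B)                    ≈⟨ ⊕-cong (T-xhat A) (·-homo T-lin n B) ⟩
        (xhat (T A) ⊕ S A) ⊕ (n · T B)            ≈⟨ ⊕-assoc (xhat (T A)) (S A) (n · T B) ⟩
        xhat (T A) ⊕ (S A ⊕ (n · T B))            ≈⟨ ⊕-congˡ {p = xhat (T A)} (⊕-congʳ S-A≐1·T-B) ⟩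
        xhat (T A) ⊕ ((1# · T B) ⊕ (n · T B))     ≈⟨ ⊕-congˡ {p = xhat (T A)} (·-distribʳ 1# n (T B)) ⟨
        xhat (T A) ⊕ (fromℕ (suc (suc k)) · T B)  ∎
        where
        A = iter (suc k) T r
        B = iter k T (S r)
        n = fromℕ (suc k)
        S-A≐1·T-B : S A ≐ (1# · T B)
        S-A≐1·T-B = ≐-trans (S-iter (suc k) r) (≐-sym (·-identityˡ (T B)))

      evalAt-xhat : ∀ f r → evalAt f T (xhat r) ≐ (xhat (evalAt f T r) ⊕ evalAt (derivS f) T (S r))
      evalAt-xhat f r = begin
        evalAt f T (xhat r)
          ≈⟨ evalAt-truncate (suc L) f (degreeBelow-xhat (degreeBelow-length r)) ⟩
        evalUpTo (suc L) f (xhat r)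
          ≈⟨ ∑P.∑-shift L _ ⟩
        (f 0 · xhat r) ⊕ sumP L (λ k → f (suc k) · iter (suc k) T (xhat r))
          ≈⟨ ⊕-congˡ (∑P.∑-cong L expand) ⟩
        (f 0 · xhat r) ⊕ sumP L (λ k → X k ⊕ Y k)
          ≈⟨ ⊕-congˡ (∑P.∑-distrib-∙ L X Y) ⟩
        (f 0 · xhat r) ⊕ (sumP L X ⊕ sumP L Y)
          ≈⟨ ⊕-assoc (f 0 · xhat r) (sumP L X) (sumP L Y) ⟨
        ((f 0 · xhat r) ⊕ sumP L X) ⊕ sumP L Y
          ≈⟨ ⊕-cong (≐-sym (xhat-evalAt f r)) derivative-part ⟩
        xhat (evalAt f T r) ⊕ evalAt (derivS f) T (S r)
          ∎
        where
        L = length r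
        X Y : ℕ → Poly
        X k = f (suc k) · xhat (iter (suc k) T r)
        Y k = f (suc k) · (fromℕ (suc k) · iter k T (S r))
        expand : ∀ k → (f (suc k) · iter (suc k) T (xhat r)) ≐ (X k ⊕ Y k)
        expand k = ≐-trans (·-congˡ (iter-xhat k r))
                           (·-distribˡ (f (suc k)) (xhat (iter (suc k) T r)) (fromℕ (suc k) · iter k T (S r)))
        derivative-part : sumP L Y ≐ evalAt (derivS f) T (S r)
        derivative-part = begin
          sumP L Y
            ≈⟨ ∑P.∑-cong L (λ k → ≐-trans (≐-sym (·-assoc _ _ _)) (·-cong (*-comm _ _) ≐-refl)) ⟩
          evalUpTo L (derivS f) (S r)
            ≈⟨ evalAt-truncate L (derivS f) (S-preserves (degreeBelow-length r)) ⟨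
          evalAt (derivS f) T (S r)
            ∎

  isLowering-D : IsLowering Dop
  isLowering-D = record
    { linear = record { cong = D-cong ; ⊕-homo = D-⊕ ; ·-homo = D-· }
    ; lowers = λ {p = p} d → degreeBelow λ i L≤i →
        trans (coeff-D p i) (trans (*-congˡ (vanishes d (suc i) (s≤s L≤i))) (zeroʳ _)) }

  D-cancel : ∀ {s s′} → coeff s 0 ≈ coeff s′ 0 → Dop s ≐ Dop s′ → s ≐ s′
  D-cancel {s} {s′} s₀≈s′₀ (≋⇒≐ Ds≋Ds′) = ≋⇒≐ λ
    { zero    → s₀≈s′₀
    ; (suc i) → fromℕ-cancelˡ i (trans (sym (coeff-D s i)) (trans (Ds≋Ds′ i) (coeff-D s′ i))) }

  powS-vanishes : ∀ {q} → q 0 ≈ 0# → ∀ k m → m < k → powS q k m ≈ 0#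
  powS-vanishes {q} q₀≈0 (suc k) m (s≤s m≤k) = ∑K.∑-≈ε (suc m) term
    where
    term : ∀ i → i < suc m → q i * powS q k (m ∸ i) ≈ 0#
    term zero    _           = trans (*-congʳ q₀≈0) (zeroˡ _)
    term (suc i) (s≤s i<m) = trans (*-congˡ (powS-vanishes q₀≈0 k (m ∸ suc i) m∸[1+i]<k)) (zeroʳ _)
      where
      m∸[1+i]<k : m ∸ suc i < k
      m∸[1+i]<k = ℕ.<-≤-trans (ℕ.∸-monoʳ-< (s≤s z≤n) i<m) m≤k

  module BellExpansion (a : ℕ → Op) (a-linear : ∀ j → IsLinear (a j))
                       (a-comm : ∀ i j p → a i (a j p) ≐ a j (a i p))
                       (a-xhat : ∀ j r → a j (xhat (a 1 r)) ≐ (xhat (a j (a 1 r)) ⊕ a (suc j) r)) where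

    -- A derivation on operators commuting with a₁, with ∂ aⱼ = aⱼ₊₁; so on A(t) = Σⱼ aⱼ tʲ/j!
    -- it gives ∂ A = A′ − a₁.
    ∂ : Op → Op
    ∂ T r = T (xhat (a 1 r)) ⊕ (⊖ xhat (T (a 1 r)))

    T-xhat-a₁ : ∀ T r → T (xhat (a 1 r)) ≐ (xhat (T (a 1 r)) ⊕ ∂ T r)
    T-xhat-a₁ T r = ≐-sym (⊕-⊖-cancel (xhat (T (a 1 r))) (T (xhat (a 1 r))))

    ∂-≐ : ∀ {S T} → (∀ s → S s ≐ T s) → ∀ r → ∂ S r ≐ ∂ T r
    ∂-≐ S≐T r = ⊕-cong (S≐T _) (⊖-cong (xhat-cong (S≐T _)))

    ∂-≐[] : ∀ {T} → (∀ s → T s ≐ []) → ∀ r → ∂ T r ≐ []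
    ∂-≐[] T≐[] r = ⊕-cong (T≐[] _) (⊖-cong (≐-trans (xhat-cong (T≐[] _)) xhat-[]))

    ∂-scalar : ∀ b r → ∂ (b ·_) r ≐ []
    ∂-scalar b r = ≐-trans (⊕-congˡ {p = b · xhat (a 1 r)} (⊖-cong (xhat-· b (a 1 r))))
                           (⊕-inverseʳ (b · xhat (a 1 r)))

    ∂-· : ∀ b T r → ∂ (λ s → b · T s) r ≐ (b · ∂ T r)
    ∂-· b T r = begin
      (b · T (xhat (a 1 r))) ⊕ (⊖ xhat (b · T (a 1 r)))
        ≈⟨ ⊕-congˡ {p = b · T (xhat (a 1 r))} (≐-trans (⊖-cong (xhat-· b _)) (⊖-· b _)) ⟩
      (b · T (xhat (a 1 r))) ⊕ (b · (⊖ xhat (T (a 1 r))))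
        ≈⟨ ·-distribˡ b (T (xhat (a 1 r))) (⊖ xhat (T (a 1 r))) ⟨
      b · ∂ T r ∎

    ∂-∑ : ∀ n (T : ℕ → Op) r → ∂ (λ s → sumP n (λ i → T i s)) r ≐ sumP n (λ i → ∂ (T i) r)
    ∂-∑ n T r = begin
      sumP n (λ i → T i (xhat (a 1 r))) ⊕ (⊖ xhat (sumP n (λ i → T i (a 1 r))))
        ≈⟨ ⊕-congˡ {p = sumP n (λ i → T i (xhat (a 1 r)))} (⊖-cong (∑-homo isLinear-xhat n _)) ⟩
      sumP n (λ i → T i (xhat (a 1 r))) ⊕ (⊖ sumP n (λ i → xhat (T i (a 1 r))))
        ≈⟨ ⊕-congˡ {p = sumP n (λ i → T i (xhat (a 1 r)))} (∑-homo ⊖-linear n _) ⟩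
      sumP n (λ i → T i (xhat (a 1 r))) ⊕ sumP n (λ i → ⊖ xhat (T i (a 1 r)))
        ≈⟨ ∑P.∑-distrib-∙ n _ _ ⟨
      sumP n (λ i → ∂ (T i) r)
        ∎
      where
      ⊖-linear : IsLinear ⊖_
      ⊖-linear = record { cong = ⊖-cong ; ⊕-homo = λ p r → ≐-sym (⁻¹-∙-comm p r) ; ·-homo = ⊖-· }

    ∂-∘ : ∀ {S T} → IsLinear S → (∀ s → T (a 1 s) ≐ a 1 (T s)) →
          ∀ r → ∂ (S ∘O T) r ≐ (S (∂ T r) ⊕ ∂ S (T r))
    ∂-∘ {S} {T} S-lin T-a₁ r = ≐-sym (begin
      S (T (xhat (a 1 r)) ⊕ (⊖ xhat (T (a 1 r)))) ⊕ ∂ S (T r)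
        ≈⟨ ⊕-congʳ {r = ∂ S (T r)} (⊕-homo S-lin _ _) ⟩
      (S (T (xhat (a 1 r))) ⊕ S (⊖ xhat (T (a 1 r)))) ⊕ ∂ S (T r)
        ≈⟨ ⊕-congʳ {r = ∂ S (T r)} (⊕-congˡ {p = X} (≐-trans (⊖-homo S-lin _) (⊖-cong (cong S-lin (xhat-cong (T-a₁ r)))))) ⟩
      (X ⊕ (⊖ Y)) ⊕ (Y ⊕ (⊖ Z))
        ≈⟨ ⊕-assoc X (⊖ Y) (Y ⊕ (⊖ Z)) ⟩
      X ⊕ ((⊖ Y) ⊕ (Y ⊕ (⊖ Z)))
        ≈⟨ ⊕-congˡ {p = X} (\\-leftDividesʳ Y (⊖ Z)) ⟩
      X ⊕ (⊖ Z)
        ≈⟨ ⊕-congˡ {p = X} (⊖-cong (xhat-cong (cong S-lin (≐-sym (T-a₁ r))))) ⟩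
      ∂ (S ∘O T) r
        ∎)
      where
      X = S (T (xhat (a 1 r)))
      Y = S (xhat (a 1 (T r)))
      Z = xhat (S (a 1 (T r)))

    ∂-a : ∀ j r → ∂ (a j) r ≐ a (suc j) r
    ∂-a j r = ≐-trans (⊕-congʳ (a-xhat j r)) (xyx⁻¹≈y (xhat (a j (a 1 r))) (a (suc j) r))

    P : ℕ → ℕ → Op
    P = powCoeff a

    powCoeff-suc : ∀ n k p → P n (suc k) p ≡ sumP n (λ i → inv! (suc i) · a (suc i) (P (n ∸ suc i) k p))
    powCoeff-suc zero    k p = ≡.refl
    powCoeff-suc (suc n) k p = ≡.refl

    isLinear-P : ∀ n k → IsLinear (P n k)
    isLinear-P zero    zero    = isLinear-id
    isLinear-P (suc n) zero    =
      record { cong = λ _ → ≐-refl ; ⊕-homo = λ _ _ → ≐-refl ; ·-homo = λ _ _ → ≐-refl }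
    isLinear-P n       (suc k) = isLinear-≐ (λ p → ≐-reflexive (powCoeff-suc n k p))
      (isLinear-∑ n (λ i → isLinear-· (inv! (suc i)) (isLinear-∘ (a-linear (suc i)) (isLinear-P (n ∸ suc i) k))))

    P-a₁ : ∀ n k r → P n k (a 1 r) ≐ a 1 (P n k r)
    P-a₁ zero    zero    r = ≐-refl
    P-a₁ (suc n) zero    r = ≐-sym ([]-homo (a-linear 1))
    P-a₁ n       (suc k) r = begin
      P n (suc k) (a 1 r)                                            ≡⟨ powCoeff-suc n k (a 1 r) ⟩
      sumP n (λ i → inv! (suc i) · a (suc i) (P (n ∸ suc i) k (a 1 r)))
        ≈⟨ ∑P.∑-cong n (λ i → ·-congˡ (≐-trans (cong (a-linear (suc i)) (P-a₁ (n ∸ suc i) k r))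
                                                 (a-comm (suc i) 1 _))) ⟩
      sumP n (λ i → inv! (suc i) · a 1 (a (suc i) (P (n ∸ suc i) k r)))
        ≈⟨ ∑P.∑-cong n (λ i → ·-homo (a-linear 1) _ _) ⟨
      sumP n (λ i → a 1 (inv! (suc i) · a (suc i) (P (n ∸ suc i) k r)))
        ≈⟨ ∑-homo (a-linear 1) n _ ⟨
      a 1 (sumP n (λ i → inv! (suc i) · a (suc i) (P (n ∸ suc i) k r)))
        ≡⟨ ≡.cong (a 1) (powCoeff-suc n k r) ⟨
      a 1 (P n (suc k) r)                                            ∎

    P-vanishes : ∀ n k → n < k → ∀ r → P n k r ≐ []
    P-vanishes n (suc k) (s≤s n≤k) r = ≐-trans (≐-reflexive (powCoeff-suc n k r)) (∑P.∑-≈ε n term)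
      where
      term : ∀ i → i < n → (inv! (suc i) · a (suc i) (P (n ∸ suc i) k r)) ≐ []
      term i i<n = ·-zeroʳ _ (≐-trans (cong (a-linear (suc i)) (P-vanishes (n ∸ suc i) k n∸[1+i]<k r))
                                      ([]-homo (a-linear (suc i))))
        where
        n∸[1+i]<k : n ∸ suc i < k
        n∸[1+i]<k = ℕ.<-≤-trans (ℕ.∸-monoʳ-< (s≤s z≤n) i<n) n≤k

    a₁-part : ℕ → ℕ → Op
    a₁-part m zero    r = []
    a₁-part m (suc k) r = fromℕ (suc k) · a 1 (P m k r)

    ∂-powCoeff-suc : ∀ n k r → ∂ (P n (suc k)) r ≐
      (sumP n (λ i → inv! (suc i) · a (suc i) (∂ (P (n ∸ suc i) k) r))
       ⊕ sumP n (λ i → inv! (suc i) · a (suc (suc i)) (P (n ∸ suc i) k r)))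
    ∂-powCoeff-suc n k r = begin
      ∂ (P n (suc k)) r
        ≈⟨ ∂-≐ (λ s → ≐-reflexive (powCoeff-suc n k s)) r ⟩
      ∂ (λ s → sumP n (λ i → w i · a (suc i) (P (m i) k s))) r
        ≈⟨ ∂-∑ n (λ i s → w i · a (suc i) (P (m i) k s)) r ⟩
      sumP n (λ i → ∂ (λ s → w i · a (suc i) (P (m i) k s)) r)
        ≈⟨ ∑P.∑-cong n (λ i → ≐-trans (∂-· (w i) (a (suc i) ∘O P (m i) k) r) (·-congˡ (leibniz i))) ⟩
      sumP n (λ i → w i · (a (suc i) (∂ (P (m i) k) r) ⊕ a (suc (suc i)) (P (m i) k r)))
        ≈⟨ ∑P.∑-cong n (λ i → ·-distribˡ (w i) (a (suc i) (∂ (P (m i) k) r)) _) ⟩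
      sumP n (λ i → (w i · a (suc i) (∂ (P (m i) k) r)) ⊕ (w i · a (suc (suc i)) (P (m i) k r)))
        ≈⟨ ∑P.∑-distrib-∙ n _ _ ⟩
      _ ∎
      where
      w : ℕ → Carrier
      w i = inv! (suc i)
      m : ℕ → ℕ
      m i = n ∸ suc i
      leibniz : ∀ i → ∂ (a (suc i) ∘O P (m i) k) r ≐ (a (suc i) (∂ (P (m i) k) r) ⊕ a (suc (suc i)) (P (m i) k r))
      leibniz i = ≐-trans (∂-∘ (a-linear (suc i)) (P-a₁ (m i) k) r)
                          (⊕-congˡ {p = a (suc i) (∂ (P (m i) k) r)} (∂-a (suc i) (P (m i) k r)))

    ∑-a₁-part : ∀ n k r →
      sumP n (λ i → inv! (suc i) · a (suc i) (a₁-part (n ∸ suc i) k r)) ≐ (fromℕ k · a 1 (P n k r))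
    ∑-a₁-part n zero    r =
      ≐-trans (∑P.∑-≈ε n (λ i _ → ·-zeroʳ _ ([]-homo (a-linear (suc i))))) (≐-sym (·-zeroˡ _ refl))
    ∑-a₁-part n (suc k) r = begin
      sumP n (λ i → w i · a (suc i) (b · a 1 (X i)))  ≈⟨ ∑P.∑-cong n move-a₁ ⟩
      sumP n (λ i → b · a 1 (w i · a (suc i) (X i)))  ≈⟨ ∑-homo (isLinear-· b (a-linear 1)) n _ ⟨
      b · a 1 (sumP n (λ i → w i · a (suc i) (X i)))  ≡⟨ ≡.cong (λ p → b · a 1 p) (powCoeff-suc n k r) ⟨
      b · a 1 (P n (suc k) r)                         ∎
      where
      b = fromℕ (suc k)
      w : ℕ → Carrier
      w i = inv! (suc i)
      X : ℕ → Poly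
      X i = P (n ∸ suc i) k r
      move-a₁ : ∀ i → (w i · a (suc i) (b · a 1 (X i))) ≐ (b · a 1 (w i · a (suc i) (X i)))
      move-a₁ i = begin
        w i · a (suc i) (b · a 1 (X i))   ≈⟨ ·-congˡ (·-homo (a-linear (suc i)) b _) ⟩
        w i · (b · a (suc i) (a 1 (X i))) ≈⟨ ·-comm (w i) b _ ⟩
        b · (w i · a (suc i) (a 1 (X i))) ≈⟨ ·-congˡ (·-congˡ (a-comm (suc i) 1 (X i))) ⟩
        b · (w i · a 1 (a (suc i) (X i))) ≈⟨ ·-congˡ (·-homo (a-linear 1) (w i) _) ⟨
        b · a 1 (w i · a (suc i) (X i))   ∎

    scaled-powCoeff-suc : ∀ n k r → (fromℕ (suc n) · P (suc n) (suc k) r) ≐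
      (sumP n (λ i → inv! (suc i) · a (suc i) (fromℕ (suc (n ∸ suc i)) · P (suc (n ∸ suc i)) k r))
       ⊕ (a 1 (P n k r) ⊕ sumP n (λ i → inv! (suc i) · a (suc (suc i)) (P (n ∸ suc i) k r))))
    scaled-powCoeff-suc n k r = begin
      fromℕ (suc n) · sumP (suc n) Y                                      ≈⟨ ·-sumP _ (suc n) Y ⟩
      sumP (suc n) (λ i → fromℕ (suc n) · Y i)                            ≈⟨ ∑P.∑-cong< (suc n) split ⟩
      sumP (suc n) (λ i → (fromℕ (suc i) · Y i) ⊕ (fromℕ (n ∸ i) · Y i))  ≈⟨ ∑P.∑-distrib-∙ (suc n) _ _ ⟩
      upper ⊕ lower                                                       ≈⟨ ⊕-comm upper lower ⟩
      lower ⊕ upper                                                       ≈⟨ ⊕-cong lower-part upper-part ⟩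
      _                                                                   ∎
      where
      w : ℕ → Carrier
      w i = inv! (suc i)
      Y : ℕ → Poly
      Y i = w i · a (suc i) (P (n ∸ i) k r)
      upper lower : Poly
      upper = sumP (suc n) (λ i → fromℕ (suc i) · Y i)
      lower = sumP (suc n) (λ i → fromℕ (n ∸ i) · Y i)
      split : ∀ i → i < suc n → (fromℕ (suc n) · Y i) ≐ ((fromℕ (suc i) · Y i) ⊕ (fromℕ (n ∸ i) · Y i))
      split i (s≤s i≤n) = ≐-trans (·-cong n+1≈[i+1]+[n-i] ≐-refl) (·-distribʳ _ _ (Y i))
        where
        n+1≈[i+1]+[n-i] : fromℕ (suc n) ≈ fromℕ (suc i) + fromℕ (n ∸ i)
        n+1≈[i+1]+[n-i] =
          trans (reflexive (≡.cong (λ m → fromℕ (suc m)) (≡.sym (ℕ.m+[n∸m]≡n i≤n)))) (fromℕ-+ (suc i) (n ∸ i))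
      lower-part : lower ≐
                   sumP n (λ i → w i · a (suc i) (fromℕ (suc (n ∸ suc i)) · P (suc (n ∸ suc i)) k r))
      lower-part = ≐-trans (⊕-congˡ {p = sumP n (λ i → fromℕ (n ∸ i) · Y i)} last≐[])
                           (≐-trans (⊕-identityʳ _) (∑P.∑-cong< n term))
        where
        last≐[] : (fromℕ (n ∸ n) · Y n) ≐ []
        last≐[] = ·-zeroˡ (Y n) (reflexive (≡.cong fromℕ (ℕ.n∸n≡0 n)))
        term : ∀ i → i < n →
               (fromℕ (n ∸ i) · Y i) ≐ (w i · a (suc i) (fromℕ (suc (n ∸ suc i)) · P (suc (n ∸ suc i)) k r))
        term i i<n rewrite n∸i≡1+[n∸1+i] i<n =
          ≐-trans (·-comm _ (w i) _) (·-congˡ (≐-sym (·-homo (a-linear (suc i)) _ _)))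
      upper-part : upper ≐ (a 1 (P n k r) ⊕ sumP n (λ i → w i · a (suc (suc i)) (P (n ∸ suc i) k r)))
      upper-part = ≐-trans (∑P.∑-shift n _) (⊕-cong first (∑P.∑-cong n rest))
        where
        first : (fromℕ 1 · Y 0) ≐ a 1 (P n k r)
        first = ≐-trans (≐-sym (·-assoc _ _ _)) (≐-trans (·-cong (trans (inv!-suc 0) inv!-0) ≐-refl) (·-identityˡ _))
        rest : ∀ i → (fromℕ (suc (suc i)) · Y (suc i)) ≐ (w i · a (suc (suc i)) (P (n ∸ suc i) k r))
        rest i = ≐-trans (≐-sym (·-assoc _ _ _)) (·-cong (inv!-suc (suc i)) ≐-refl)

    -- The tᵐ-coefficient of (Aᵏ)′ = ∂ (Aᵏ) + k a₁ Aᵏ⁻¹.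
    powCoeff-derivative : ∀ k m r → (∂ (P m k) r ⊕ a₁-part m k r) ≐ (fromℕ (suc m) · P (suc m) k r)
    powCoeff-derivative zero zero    r = ≐-trans (⊕-identityʳ _) (⊕-inverseʳ (xhat (a 1 r)))
    powCoeff-derivative zero (suc m) r = ≐-trans (⊕-identityʳ _) (∂-≐[] (λ _ → ≐-refl) r)
    powCoeff-derivative (suc k) n r = begin
      ∂ (P n (suc k)) r ⊕ (fromℕ (suc k) · a₁P)
        ≈⟨ ⊕-cong (∂-powCoeff-suc n k r) (·-distribʳ 1# (fromℕ k) a₁P) ⟩
      (∑U ⊕ ∑V) ⊕ ((1# · a₁P) ⊕ (fromℕ k · a₁P))
        ≈⟨ ⊕-congˡ {p = ∑U ⊕ ∑V} (≐-trans (⊕-comm (1# · a₁P) _)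
                                          (⊕-cong (≐-sym (∑-a₁-part n k r)) (·-identityˡ a₁P))) ⟩
      (∑U ⊕ ∑V) ⊕ (∑W ⊕ a₁P)
        ≈⟨ interchange ∑U ∑V ∑W a₁P ⟩
      (∑U ⊕ ∑W) ⊕ (∑V ⊕ a₁P)
        ≈⟨ ⊕-cong (≐-trans (≐-sym (∑P.∑-distrib-∙ n U W)) (∑P.∑-cong n induction-hypothesis))
                  (⊕-comm ∑V a₁P) ⟩
      ∑B ⊕ (a₁P ⊕ ∑V)
        ≈⟨ scaled-powCoeff-suc n k r ⟨
      fromℕ (suc n) · P (suc n) (suc k) r ∎
      where
      w : ℕ → Carrier
      w i = inv! (suc i)
      m : ℕ → ℕ
      m i = n ∸ suc i
      a₁P = a 1 (P n k r)
      U W : ℕ → Poly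
      U i = w i · a (suc i) (∂ (P (m i) k) r)
      W i = w i · a (suc i) (a₁-part (m i) k r)
      ∑U ∑V ∑W ∑B : Poly
      ∑U = sumP n U
      ∑V = sumP n (λ i → w i · a (suc (suc i)) (P (m i) k r))
      ∑W = sumP n W
      ∑B = sumP n (λ i → w i · a (suc i) (fromℕ (suc (m i)) · P (suc (m i)) k r))
      induction-hypothesis : ∀ i → (U i ⊕ W i) ≐ (w i · a (suc i) (fromℕ (suc (m i)) · P (suc (m i)) k r))
      induction-hypothesis i = begin
        U i ⊕ W i
          ≈⟨ ·-distribˡ (w i) (a (suc i) (∂ (P (m i) k) r)) _ ⟨
        w i · (a (suc i) (∂ (P (m i) k) r) ⊕ a (suc i) (a₁-part (m i) k r))
          ≈⟨ ·-congˡ (⊕-homo (a-linear (suc i)) _ _) ⟨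
        w i · a (suc i) (∂ (P (m i) k) r ⊕ a₁-part (m i) k r)
          ≈⟨ ·-congˡ (cong (a-linear (suc i)) (powCoeff-derivative k (m i) r)) ⟩
        w i · a (suc i) (fromℕ (suc (m i)) · P (suc (m i)) k r) ∎

    B : ℕ → ℕ → Op
    B = bell a

    B-a₁ : ∀ n k r → B n k (a 1 r) ≐ a 1 (B n k r)
    B-a₁ n k r = ≐-trans (·-congˡ (P-a₁ n k r)) (≐-sym (·-homo (a-linear 1) _ _))

    B-0-0 : ∀ r → B 0 0 r ≐ r
    B-0-0 r = ≐-trans (·-cong (inverseʳ (fromℕ 1) (charZero 0)) ≐-refl) (·-identityˡ r)

    B-vanishes : ∀ n r → B n (suc n) r ≐ []
    B-vanishes n r = ·-zeroʳ _ (P-vanishes n (suc n) ℕ.≤-refl r)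

    ∂-B-0 : ∀ n r → ∂ (B n 0) r ≐ []
    ∂-B-0 zero    r = ∂-scalar _ r
    ∂-B-0 (suc n) r = ∂-≐[] (λ _ → ≐-refl) r

    B-suc : ∀ n k r → B (suc n) (suc k) r ≐ (∂ (B n (suc k)) r ⊕ a 1 (B n k r))
    B-suc n k r = begin
      B (suc n) (suc k) r
        ≈⟨ ·-cong (*-congʳ (fromℕ-* (suc n) (n !))) ≐-refl ⟩
      ((fromℕ (suc n) * fromℕ (n !)) * inv! (suc k)) · P (suc n) (suc k) r
        ≈⟨ ·-cong (xy∙z≈yz∙x _ _ _) ≐-refl ⟩
      (b * fromℕ (suc n)) · P (suc n) (suc k) r
        ≈⟨ ·-assoc b _ _ ⟩
      b · (fromℕ (suc n) · P (suc n) (suc k) r)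
        ≈⟨ ·-congˡ (powCoeff-derivative (suc k) n r) ⟨
      b · (∂ (P n (suc k)) r ⊕ (fromℕ (suc k) · a 1 (P n k r)))
        ≈⟨ ·-distribˡ b (∂ (P n (suc k)) r) _ ⟩
      (b · ∂ (P n (suc k)) r) ⊕ (b · (fromℕ (suc k) · a 1 (P n k r)))
        ≈⟨ ⊕-cong (≐-sym (∂-· b (P n (suc k)) r)) a₁-term ⟩
      ∂ (B n (suc k)) r ⊕ a 1 (B n k r) ∎
      where
      b = fromℕ (n !) * inv! (suc k)
      open CommutativeSemigroupProperties *-commutativeSemigroup using (xy∙z≈yz∙x)
      a₁-term : (b · (fromℕ (suc k) · a 1 (P n k r))) ≐ a 1 (B n k r)
      a₁-term = begin
        b · (fromℕ (suc k) · a 1 (P n k r))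
          ≈⟨ ·-assoc b _ _ ⟨
        (b * fromℕ (suc k)) · a 1 (P n k r)
          ≈⟨ ·-cong (trans (*-assoc _ _ _) (*-congˡ (trans (*-comm _ _) (inv!-suc k)))) ≐-refl ⟩
        (fromℕ (n !) * inv! k) · a 1 (P n k r)
          ≈⟨ ·-homo (a-linear 1) _ _ ⟨
        a 1 (B n k r) ∎

    iter-xhat-B-xhat-a₁ : ∀ n k r →
      iter k xhat (B n k (xhat (a 1 r))) ≐ (iter (suc k) xhat (a 1 (B n k r)) ⊕ iter k xhat (∂ (B n k) r))
    iter-xhat-B-xhat-a₁ n k r = begin
      iter k xhat (B n k (xhat (a 1 r)))
        ≈⟨ cong (isLinear-xhatᵏ k) (T-xhat-a₁ (B n k) r) ⟩
      iter k xhat (xhat (B n k (a 1 r)) ⊕ ∂ (B n k) r)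
        ≈⟨ ⊕-homo (isLinear-xhatᵏ k) _ _ ⟩
      iter k xhat (xhat (B n k (a 1 r))) ⊕ iter k xhat (∂ (B n k) r)
        ≈⟨ ⊕-congʳ {r = iter k xhat (∂ (B n k) r)}
             (≐-trans (≐-reflexive (iter-suc k xhat _)) (xhat-cong (cong (isLinear-xhatᵏ k) (B-a₁ n k r)))) ⟩
      iter (suc k) xhat (a 1 (B n k r)) ⊕ iter k xhat (∂ (B n k) r) ∎

    ∑-iter-xhat-∂B-shift : ∀ n r → sumP (suc n) (λ k → iter k xhat (∂ (B n k) r)) ≐
                                   sumP (suc n) (λ k → iter (suc k) xhat (∂ (B n (suc k)) r))
    ∑-iter-xhat-∂B-shift n r = begin
      sumP (suc n) (λ k → iter k xhat (∂ (B n k) r))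
        ≈⟨ ∑P.∑-shift n _ ⟩
      ∂ (B n 0) r ⊕ ∑∂B
        ≈⟨ ⊕-congʳ (∂-B-0 n r) ⟩
      ∑∂B
        ≈⟨ ⊕-identityʳ _ ⟨
      ∑∂B ⊕ []
        ≈⟨ ⊕-congˡ {p = ∑∂B} last≐[] ⟨
      sumP (suc n) (λ k → iter (suc k) xhat (∂ (B n (suc k)) r)) ∎
      where
      ∑∂B = sumP n (λ k → iter (suc k) xhat (∂ (B n (suc k)) r))
      last≐[] : iter (suc n) xhat (∂ (B n (suc n)) r) ≐ []
      last≐[] = ≐-trans (cong (isLinear-xhatᵏ (suc n)) (∂-≐[] (B-vanishes n) r)) ([]-homo (isLinear-xhatᵏ (suc n)))

    iter-xhat-B-suc : ∀ n k r → (iter (suc k) xhat (a 1 (B n k r)) ⊕ iter (suc k) xhat (∂ (B n (suc k)) r)) ≐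
                                iter (suc k) xhat (B (suc n) (suc k) r)
    iter-xhat-B-suc n k r = begin
      iter (suc k) xhat (a 1 (B n k r)) ⊕ iter (suc k) xhat (∂ (B n (suc k)) r)
        ≈⟨ ⊕-comm (iter (suc k) xhat (a 1 (B n k r))) (iter (suc k) xhat (∂ (B n (suc k)) r)) ⟩
      iter (suc k) xhat (∂ (B n (suc k)) r) ⊕ iter (suc k) xhat (a 1 (B n k r))
        ≈⟨ ⊕-homo (isLinear-xhatᵏ (suc k)) _ _ ⟨
      iter (suc k) xhat (∂ (B n (suc k)) r ⊕ a 1 (B n k r))
        ≈⟨ cong (isLinear-xhatᵏ (suc k)) (B-suc n k r) ⟨
      iter (suc k) xhat (B (suc n) (suc k) r) ∎

    bell-expansion : ∀ n r → iter n (xhat ∘O a 1) r ≐ sumP (suc n) (λ k → iter k xhat (B n k r))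
    bell-expansion zero    r = ≐-sym (B-0-0 r)
    bell-expansion (suc n) r = begin
      iter (suc n) (xhat ∘O a 1) r
        ≡⟨ iter-suc n (xhat ∘O a 1) r ⟨
      iter n (xhat ∘O a 1) (xhat (a 1 r))
        ≈⟨ bell-expansion n (xhat (a 1 r)) ⟩
      sumP (suc n) (λ k → iter k xhat (B n k (xhat (a 1 r))))
        ≈⟨ ∑P.∑-cong (suc n) (λ k → iter-xhat-B-xhat-a₁ n k r) ⟩
      sumP (suc n) (λ k → iter (suc k) xhat (a 1 (B n k r)) ⊕ iter k xhat (∂ (B n k) r))
        ≈⟨ ∑P.∑-distrib-∙ (suc n) _ _ ⟩
      ∑a₁B ⊕ sumP (suc n) (λ k → iter k xhat (∂ (B n k) r))
        ≈⟨ ⊕-congˡ {p = ∑a₁B} (∑-iter-xhat-∂B-shift n r) ⟩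
      ∑a₁B ⊕ sumP (suc n) (λ k → iter (suc k) xhat (∂ (B n (suc k)) r))
        ≈⟨ ∑P.∑-distrib-∙ (suc n) _ _ ⟨
      sumP (suc n) (λ k → iter (suc k) xhat (a 1 (B n k r)) ⊕ iter (suc k) xhat (∂ (B n (suc k)) r))
        ≈⟨ ∑P.∑-cong (suc n) (λ k → iter-xhat-B-suc n k r) ⟩
      sumP (suc n) (λ k → iter (suc k) xhat (B (suc n) (suc k) r))
        ≈⟨ ∑P.∑-shift (suc n) (λ k → iter k xhat (B (suc n) k r)) ⟨
      sumP (suc (suc n)) (λ k → iter k xhat (B (suc n) k r)) ∎
      where ∑a₁B = sumP (suc n) (λ k → iter (suc k) xhat (a 1 (B n k r)))

  module DeltaOperator {Q : Op} {q : Series} (Q-delta : IsDeltaWithIndicator Q q)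
                       {g : Series} (g₀≈0 : g 0 ≈ 0#) (g∘q≈t : compS g q ≈S tS) where

    open IsDeltaWithIndicator Q-delta
    module SeriesD = PowerSeriesOf isLowering-D

    -- Q x = q(D) x is constant, and its coefficient of x reduces to q₀ * 1.
    q₀≈0 : q 0 ≈ 0#
    q₀≈0 = trans (sym (*-identityʳ (q 0))) (trans (sym (indicator (mono 1) 1)) (proj₂ (proj₂ Qx-const) 1))

    Q≐q[D] : ∀ p → Q p ≐ evalAt q Dop p
    Q≐q[D] p = ≋⇒≐ (indicator p)

    isLowering-Q : IsLowering Q
    isLowering-Q = isLowering-≐ Q≐q[D] (SeriesD.isLowering-evalAt q q₀≈0)

    module SeriesQ = PowerSeriesOf isLowering-Q

    Q′ : Op
    Q′ = pincherle Q

    module CommutatorD = SeriesD.Commutator isLinear-id (λ d → d) D-xhat (λ _ → ≐-refl)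

    Q′≐q′[D] : ∀ r → Q′ r ≐ evalAt (derivS q) Dop r
    Q′≐q′[D] r = begin
      Q (xhat r) ⊕ (⊖ xhat (Q r))
        ≈⟨ ⊕-cong (Q≐q[D] (xhat r)) (⊖-cong (xhat-cong (Q≐q[D] r))) ⟩
      evalAt q Dop (xhat r) ⊕ (⊖ X)
        ≈⟨ ⊕-congʳ (CommutatorD.evalAt-xhat q r) ⟩
      (X ⊕ evalAt (derivS q) Dop r) ⊕ (⊖ X)
        ≈⟨ xyx⁻¹≈y X _ ⟩
      evalAt (derivS q) Dop r ∎
      where X = xhat (evalAt q Dop r)

    isLinear-Q′ : IsLinear Q′
    isLinear-Q′ = isLinear-≐ Q′≐q′[D] (SeriesD.isLinear-evalAt (derivS q))

    Q′-preserves : ∀ {L p} → DegreeBelow L p → DegreeBelow L (Q′ p)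
    Q′-preserves {p = p} d = degreeBelow-≐ (≐-sym (Q′≐q′[D] p)) (SeriesD.evalAt-preserves (derivS q) d)

    Q-xhat : ∀ r → Q (xhat r) ≐ (xhat (Q r) ⊕ Q′ r)
    Q-xhat r = ≐-sym (⊕-⊖-cancel (xhat (Q r)) (Q (xhat r)))

    Q′-Q : ∀ r → Q′ (Q r) ≐ Q (Q′ r)
    Q′-Q r = begin
      Q′ (Q r)                                        ≈⟨ Q′≐q′[D] (Q r) ⟩
      evalAt (derivS q) Dop (Q r)                     ≈⟨ cong (SeriesD.isLinear-evalAt (derivS q)) (Q≐q[D] r) ⟩
      evalAt (derivS q) Dop (evalAt q Dop r)          ≈⟨ SeriesD.evalAt-comm (derivS q) q r ⟩
      evalAt q Dop (evalAt (derivS q) Dop r)          ≈⟨ Q≐q[D] _ ⟨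
      Q (evalAt (derivS q) Dop r)                     ≈⟨ cong (linear isLowering-Q) (Q′≐q′[D] r) ⟨
      Q (Q′ r)                                        ∎

    module CommutatorQ = SeriesQ.Commutator isLinear-Q′ Q′-preserves Q-xhat Q′-Q

    iter-Q : ∀ k p → iter k Q p ≐ evalAt (powS q k) Dop p
    iter-Q zero    p = ≐-sym (SeriesD.evalAt-oneS p)
    iter-Q (suc k) p = begin
      Q (iter k Q p)                            ≈⟨ cong (linear isLowering-Q) (iter-Q k p) ⟩
      Q (evalAt (powS q k) Dop p)               ≈⟨ Q≐q[D] _ ⟩
      evalAt q Dop (evalAt (powS q k) Dop p)    ≈⟨ SeriesD.evalAt-mulS q (powS q k) p ⟩
      evalAt (powS q (suc k)) Dop p             ∎

    evalAt-Q : ∀ f p → evalAt f Q p ≐ evalAt (compS f q) Dop p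
    evalAt-Q f p = begin
      evalAt f Q p
        ≈⟨ SeriesQ.evalAt-truncate M f (degreeBelow-length p) ⟩
      sumP M (λ k → f k · iter k Q p)
        ≈⟨ ∑P.∑-cong M (λ k → ·-congˡ (≐-trans (iter-Q k p)
                                         (SeriesD.evalAt-truncate M (powS q k) (degreeBelow-length p)))) ⟩
      sumP M (λ k → f k · sumP M (λ m → powS q k m · iter m Dop p))
        ≈⟨ ∑P.∑-cong M (λ k → ≐-trans (·-sumP (f k) M _) (∑P.∑-cong M (λ m → ≐-sym (·-assoc (f k) _ _)))) ⟩
      sumP M (λ k → sumP M (λ m → (f k * powS q k m) · iter m Dop p))
        ≈⟨ ∑P.∑-comm M M _ ⟩
      sumP M (λ m → sumP M (λ k → (f k * powS q k m) · iter m Dop p))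
        ≈⟨ ∑P.∑-cong M (λ m → ≐-sym (sumK-· M _ _)) ⟩
      sumP M (λ m → sumK M (λ k → f k * powS q k m) · iter m Dop p)
        ≈⟨ ∑P.∑-cong< M (λ m m<M → ·-cong (∑K.∑-trim (suc m) M (high-powers-vanish m) m<M) ≐-refl) ⟩
      SeriesD.evalUpTo M (compS f q) p
        ≈⟨ SeriesD.evalAt-truncate M (compS f q) (degreeBelow-length p) ⟨
      evalAt (compS f q) Dop p
        ∎
      where
      M = length p
      high-powers-vanish : ∀ m k → suc m ≤ k → f k * powS q k m ≈ 0#
      high-powers-vanish m k m<k = trans (*-congˡ (powS-vanishes q₀≈0 k m m<k)) (zeroʳ _)

    D≐g[Q] : ∀ p → Dop p ≐ evalAt g Q p
    D≐g[Q] p = begin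
      Dop p                     ≈⟨ SeriesD.evalAt-tS p ⟨
      evalAt tS Dop p           ≈⟨ SeriesD.evalAt-≈S g∘q≈t p ⟨
      evalAt (compS g q) Dop p  ≈⟨ evalAt-Q g p ⟨
      evalAt g Q p              ∎

    g′[Q]-Q′ : ∀ s → evalAt (derivS g) Q (Q′ s) ≐ s
    g′[Q]-Q′ s = ∙-cancelˡ (xhat (Dop s)) (evalAt (derivS g) Q (Q′ s)) s (begin
      xhat (Dop s) ⊕ evalAt (derivS g) Q (Q′ s)
        ≈⟨ ⊕-congʳ {r = evalAt (derivS g) Q (Q′ s)} (xhat-cong (D≐g[Q] s)) ⟩
      xhat (evalAt g Q s) ⊕ evalAt (derivS g) Q (Q′ s)
        ≈⟨ CommutatorQ.evalAt-xhat g s ⟨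
      evalAt g Q (xhat s)
        ≈⟨ D≐g[Q] (xhat s) ⟨
      Dop (xhat s)
        ≈⟨ D-xhat s ⟩
      xhat (Dop s) ⊕ s ∎)

    Q′-g′[Q] : ∀ s → Q′ (evalAt (derivS g) Q s) ≐ s
    Q′-g′[Q] s = begin
      Q′ (evalAt g′ Q s)
        ≈⟨ ≐-trans (Q′≐q′[D] _) (cong (SeriesD.isLinear-evalAt (derivS q)) (evalAt-Q g′ s)) ⟩
      evalAt (derivS q) Dop (evalAt (compS g′ q) Dop s)
        ≈⟨ SeriesD.evalAt-comm (derivS q) (compS g′ q) s ⟩
      evalAt (compS g′ q) Dop (evalAt (derivS q) Dop s)
        ≈⟨ ≐-trans (evalAt-Q g′ (Q′ s)) (cong (SeriesD.isLinear-evalAt (compS g′ q)) (Q′≐q′[D] s)) ⟨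
      evalAt g′ Q (Q′ s)
        ≈⟨ g′[Q]-Q′ s ⟩
      s ∎
      where g′ = derivS g

    -- g(Q) has no constant term, so D = g(Q) sees s only through Q s.
    Q-cancel : ∀ {s s′} → coeff s 0 ≈ coeff s′ 0 → Q s ≐ Q s′ → s ≐ s′
    Q-cancel {s} {s′} s₀≈s′₀ Qs≐Qs′ = D-cancel s₀≈s′₀ (begin
      Dop s                     ≈⟨ D≐g[Q] s ⟩
      evalAt g Q s              ≈⟨ SeriesQ.evalAt-truncate M g ds ⟩
      SeriesQ.evalUpTo M g s    ≈⟨ ∑P.∑-cong M term ⟩
      SeriesQ.evalUpTo M g s′   ≈⟨ SeriesQ.evalAt-truncate M g ds′ ⟨
      evalAt g Q s′             ≈⟨ D≐g[Q] s′ ⟨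
      Dop s′                    ∎)
      where
      M = length s ℕ.+ length s′
      ds = degreeBelow-mono (ℕ.m≤m+n (length s) (length s′)) (degreeBelow-length s)
      ds′ = degreeBelow-mono (ℕ.m≤n+m (length s′) (length s)) (degreeBelow-length s′)
      term : ∀ k → (g k · iter k Q s) ≐ (g k · iter k Q s′)
      term zero    = ≐-trans (·-zeroˡ s g₀≈0) (≐-sym (·-zeroˡ s′ g₀≈0))
      term (suc k) = ·-congˡ (begin
        Q (iter k Q s)    ≡⟨ iter-suc k Q s ⟨
        iter k Q (Q s)    ≈⟨ cong (isLinear-iter (linear isLowering-Q) k) Qs≐Qs′ ⟩
        iter k Q (Q s′)   ≡⟨ iter-suc k Q s′ ⟩
        Q (iter k Q s′)   ∎)

    g⁽ʲ⁾[Q] : ℕ → Op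
    g⁽ʲ⁾[Q] j = evalAt (derivN j g) Q

    isLinear-g⁽ʲ⁾[Q] : ∀ j → IsLinear (g⁽ʲ⁾[Q] j)
    isLinear-g⁽ʲ⁾[Q] j = SeriesQ.isLinear-evalAt (derivN j g)

    g⁽ʲ⁾[Q]-comm : ∀ i j p → g⁽ʲ⁾[Q] i (g⁽ʲ⁾[Q] j p) ≐ g⁽ʲ⁾[Q] j (g⁽ʲ⁾[Q] i p)
    g⁽ʲ⁾[Q]-comm i j = SeriesQ.evalAt-comm (derivN i g) (derivN j g)

    g⁽ʲ⁾[Q]-xhat : ∀ j r →
      g⁽ʲ⁾[Q] j (xhat (g⁽ʲ⁾[Q] 1 r)) ≐ (xhat (g⁽ʲ⁾[Q] j (g⁽ʲ⁾[Q] 1 r)) ⊕ g⁽ʲ⁾[Q] (suc j) r)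
    g⁽ʲ⁾[Q]-xhat j r = ≐-trans (CommutatorQ.evalAt-xhat (derivN j g) (g⁽ʲ⁾[Q] 1 r))
                               (⊕-congˡ {p = xhat (g⁽ʲ⁾[Q] j (g⁽ʲ⁾[Q] 1 r))}
                                        (cong (isLinear-g⁽ʲ⁾[Q] (suc j)) (Q′-g′[Q] r)))

    module InversePincherle {R : Op} (Q′-R : ∀ p → Q′ (R p) ≐ p) where

      R≐g′[Q] : ∀ p → R p ≐ g⁽ʲ⁾[Q] 1 p
      R≐g′[Q] p = ≐-trans (≐-sym (g′[Q]-Q′ (R p))) (cong (isLinear-g⁽ʲ⁾[Q] 1) (Q′-R p))

      isLinear-R : IsLinear R
      isLinear-R = isLinear-≐ R≐g′[Q] (isLinear-g⁽ʲ⁾[Q] 1)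

      isLinear-xhat∘R : IsLinear (xhat ∘O R)
      isLinear-xhat∘R = isLinear-∘ isLinear-xhat isLinear-R

      Q-R : ∀ r → Q (R r) ≐ R (Q r)
      Q-R r = begin
        Q (R r)              ≈⟨ cong (linear isLowering-Q) (R≐g′[Q] r) ⟩
        Q (g⁽ʲ⁾[Q] 1 r)      ≈⟨ SeriesQ.T-evalAt (derivS g) r ⟩
        g⁽ʲ⁾[Q] 1 (Q r)      ≈⟨ R≐g′[Q] (Q r) ⟨
        R (Q r)              ∎

      Q-xhat-R : ∀ r → Q (xhat (R r)) ≐ (xhat (R (Q r)) ⊕ r)
      Q-xhat-R r = begin
        Q (xhat (R r))               ≈⟨ Q-xhat (R r) ⟩
        xhat (Q (R r)) ⊕ Q′ (R r)    ≈⟨ ⊕-cong (xhat-cong (Q-R r)) (Q′-R r) ⟩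
        xhat (R (Q r)) ⊕ r           ∎

      module BasicSequence {φ : ℕ → Poly} (φ-basic : IsBasicSequence Q φ) where

        open IsBasicSequence φ-basic

        φ-suc : ∀ n → φ (suc n) ≐ xhat (R (φ n))
        Q-xhat-R-φ : ∀ n → Q (xhat (R (φ n))) ≐ (fromℕ (suc n) · φ n)

        φ-suc n = ≐-sym (Q-cancel (sym (φₙ0 n)) (≐-trans (Q-xhat-R-φ n) (≐-sym (≋⇒≐ (lower n)))))

        Q-xhat-R-φ zero = begin
          Q (xhat (R (φ 0)))
            ≈⟨ Q-xhat-R (φ 0) ⟩
          xhat (R (Q (φ 0))) ⊕ φ 0
            ≈⟨ ⊕-congʳ (≐-trans (xhat-cong (≐-trans (cong isLinear-R Qφ₀≐[]) ([]-homo isLinear-R))) xhat-[]) ⟩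
          φ 0
            ≈⟨ fromℕ1· (φ 0) ⟨
          fromℕ 1 · φ 0 ∎
          where
          Qφ₀≐[] : Q (φ 0) ≐ []
          Qφ₀≐[] = degreeBelow-0 (lowers isLowering-Q
                     (degreeBelow-≐ (≐-sym (≋⇒≐ φ₀)) (degreeBelow-length [ 1# ])))
        Q-xhat-R-φ (suc m) = begin
          Q (xhat (R (φ (suc m))))
            ≈⟨ Q-xhat-R (φ (suc m)) ⟩
          xhat (R (Q (φ (suc m)))) ⊕ φ (suc m)
            ≈⟨ ⊕-congʳ {r = φ (suc m)} (cong isLinear-xhat∘R (≋⇒≐ (lower m))) ⟩
          xhat (R (n · φ m)) ⊕ φ (suc m)
            ≈⟨ ⊕-congʳ {r = φ (suc m)} (·-homo isLinear-xhat∘R n (φ m)) ⟩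
          (n · xhat (R (φ m))) ⊕ φ (suc m)
            ≈⟨ ⊕-congʳ {r = φ (suc m)} (·-congˡ (≐-sym (φ-suc m))) ⟩
          (n · φ (suc m)) ⊕ φ (suc m)
            ≈⟨ ⊕-comm (n · φ (suc m)) (φ (suc m)) ⟩
          φ (suc m) ⊕ (n · φ (suc m))
            ≈⟨ ⊕-congʳ (≐-sym (·-identityˡ (φ (suc m)))) ⟩
          (1# · φ (suc m)) ⊕ (n · φ (suc m))
            ≈⟨ ·-distribʳ 1# n (φ (suc m)) ⟨
          fromℕ (suc (suc m)) · φ (suc m) ∎
          where n = fromℕ (suc m)

        umbral-xhat : ∀ p → umbral φ (xhat p) ≐ xhat (R (umbral φ p))
        umbral-xhat p = begin
          umbral φ (xhat p)
            ≈⟨ ∑P.∑-shift (length p) _ ⟩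
          (0# · φ 0) ⊕ sumP (length p) (λ i → coeff p i · φ (suc i))
            ≈⟨ ⊕-cong (·-zeroˡ (φ 0) refl) (∑P.∑-cong (length p) (λ i → ·-congˡ (φ-suc i))) ⟩
          sumP (length p) (λ i → coeff p i · xhat (R (φ i)))
            ≈⟨ ∑P.∑-cong (length p) (λ i → ·-homo isLinear-xhat∘R (coeff p i) (φ i)) ⟨
          sumP (length p) (λ i → xhat (R (coeff p i · φ i)))
            ≈⟨ ∑-homo isLinear-xhat∘R (length p) _ ⟨
          xhat (R (umbral φ p)) ∎

        umbral-iter-xhat : ∀ n p → umbral φ (iter n xhat p) ≐ iter n (xhat ∘O R) (umbral φ p)
        umbral-iter-xhat zero    p = ≐-refl
        umbral-iter-xhat (suc n) p =
          ≐-trans (umbral-xhat (iter n xhat p)) (cong isLinear-xhat∘R (umbral-iter-xhat n p))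

mainTheorem7 : ∀ {c ℓ} (F : CharZeroField c ℓ) → let open Over F in
    (Q : Op) (q : Series) → IsDeltaWithIndicator Q q →
    (g : Series) → CharZeroField._≈_ F (g 0) (CharZeroField.0# F) →
    compS q g ≈S tS → compS g q ≈S tS →
    (φ : ℕ → Poly) → IsBasicSequence Q φ →
    (Q'⁻¹ : Op) → (∀ p → pincherle Q (Q'⁻¹ p) ≋ p) → (∀ p → Q'⁻¹ (pincherle Q p) ≋ p) →
    ∀ (n : ℕ) (p : Poly) →
      (umbral φ (iter n xhat p) ≋ iter n (xhat ∘O Q'⁻¹) (umbral φ p))
      × (umbral φ (iter n xhat p)
          ≋ sumP (suc n) (λ k → iter k xhat (bell (λ j → evalAt (derivN j g) Q) n k (umbral φ p))))
mainTheorem7 F Q q Q-delta g g₀≈0 _ g∘q≈t φ φ-basic R Q′-R _ n p =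
  ≐⇒≋ umbral-formula , ≐⇒≋ (≐-trans umbral-formula (≐-trans R-as-g′[Q] (bell-expansion n (umbral φ p))))
  where
  open Over F
  open UmbralCalculus F
  open DeltaOperator Q-delta g₀≈0 g∘q≈t
  open InversePincherle (λ p → ≋⇒≐ (Q′-R p))
  open BasicSequence φ-basic
  open BellExpansion g⁽ʲ⁾[Q] isLinear-g⁽ʲ⁾[Q] g⁽ʲ⁾[Q]-comm g⁽ʲ⁾[Q]-xhat
  umbral-formula : umbral φ (iter n xhat p) ≐ iter n (xhat ∘O R) (umbral φ p)
  umbral-formula = umbral-iter-xhat n p
  R-as-g′[Q] : iter n (xhat ∘O R) (umbral φ p) ≐ iter n (xhat ∘O g⁽ʲ⁾[Q] 1) (umbral φ p)
  R-as-g′[Q] =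
    iter-≐ (λ s → xhat-cong (R≐g′[Q] s)) (isLinear-∘ isLinear-xhat (isLinear-g⁽ʲ⁾[Q] 1)) n (umbral φ p)
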